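{- Let $x,y,n$ be odd positive integers with $n\ge3$, and let $s_p$ be an integer with $0\le s_p\le 4xy$ and $s_p\notin\{1,4xy-1\}$. Then there is a decomposition of $C_{(4xy:n)}$ into $s_p$ $C_{2xn}$-factors and $r_p=4xy-s_p$ $C_{yn}$-factors.
   Context: For positive integers $v$ and $k\ge3$, $C_{(v:k)}$ is the graph with vertex set $\{(g,i):0\le g\le v-1,\ i\in\mathbb{Z}_k\}$ in which $(g,i)$ and $(h,j)$ are adjacent iff $i-j\equiv\pm1\pmod k$. A $C_\ell$-factor is a spanning subgraph each of whose components is a cycle of length $\ell$. -}

module Defs where

open import Data.Nat using (ℕ; zero; suc; _+_; _*_; _∸_; _≤_)
open import Data.Nat.DivMod using (_mod_)
open import Data.Fin using (Fin; toℕ)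
open import Data.Product using (Σ; _×_; _,_; ∃)
open import Data.Sum using (_⊎_)
open import Function.Definitions using (Bijective)
open import Relation.Binary.PropositionalEquality using (_≡_)

IsOdd : ℕ → Set
IsOdd m = ∃ λ j → m ≡ suc (2 * j)

next : ∀ {ℓ} → Fin ℓ → Fin ℓ
next {suc m} i = suc (toℕ i) mod (suc m)

-- Vertices of C_(v:k): pairs (g , i) with 0 ≤ g ≤ v-1, i ∈ ℤ_k
Vtx : ℕ → ℕ → Set
Vtx v k = Fin v × Fin k

Adj : ∀ {v k} → Vtx v k → Vtx v k → Set
Adj (g , i) (h , j) = (j ≡ next i) ⊎ (i ≡ next j)

SameEdge : {V : Set} → V → V → V → V → Set
SameEdge u w a b = (u ≡ a × w ≡ b) ⊎ (u ≡ b × w ≡ a)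

-- A C_ℓ-factor of the graph (V , E): a spanning subgraph whose components
-- are cycles of length ℓ. It is given by t cycles cyc a : Fin ℓ → V
-- (a < t), whose vertices together are every vertex exactly once
-- (the map (a , i) ↦ cyc a i is a bijection onto V), and whose edges
-- {cyc a i , cyc a (i+1)} are edges of the graph. The edge set of the
-- factor is exactly the set of these cycle edges.
record CycleFactor (V : Set) (E : V → V → Set) (ℓ : ℕ) : Set where
  field
    t     : ℕ
    cyc   : Fin t → Fin ℓ → V
    bij   : Bijective _≡_ _≡_ (λ (p : Fin t × Fin ℓ) → cyc (Data.Product.proj₁ p) (Data.Product.proj₂ p))
    edges : ∀ a i → E (cyc a i) (cyc a (next i))
open CycleFactor public

-- A decomposition of (V , E) into a family of cycle factors indexed by I,
-- factor f being a C_(len f)-factor: every edge of the graph lies in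
-- exactly one factor (and in exactly one position of one of its cycles).
record Decomposition (V : Set) (E : V → V → Set) (I : Set) (len : I → ℕ) : Set where
  field
    factor : (f : I) → CycleFactor V E (len f)
  Occ : Set
  Occ = Σ I λ f → Fin (t (factor f)) × Fin (len f)
  endpoints : Occ → V × V
  endpoints (f , a , i) = cyc (factor f) a i , cyc (factor f) a (next i)
  field
    cover  : ∀ u w → E u w → Σ Occ λ o →
               SameEdge u w (Data.Product.proj₁ (endpoints o)) (Data.Product.proj₂ (endpoints o))
    unique : ∀ u w (o o′ : Occ) →
               SameEdge u w (Data.Product.proj₁ (endpoints o)) (Data.Product.proj₂ (endpoints o)) →
               SameEdge u w (Data.Product.proj₁ (endpoints o′)) (Data.Product.proj₂ (endpoints o′)) →
               o ≡ o′

twoLengths : ∀ {s r} → ℕ → ℕ → Fin s ⊎ Fin r → ℕ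
twoLengths a b (Data.Sum.inj₁ _) = a
twoLengths a b (Data.Sum.inj₂ _) = b

HasDecomposition : (v k s r a b : ℕ) → Set
HasDecomposition v k s r a b =
  Decomposition (Vtx v k) (Adj {v} {k}) (Fin s ⊎ Fin r) (twoLengths {s} {r} a b)

-- Let G = ℤ₂ × ℤ₂ₓ × ℤ_y, of order v = 4xy, and read the vertex (g , i) of C_(v:n) as the
-- element g in layer i. Choose for every layer k a bijection d_k from the v factor indices
-- onto G and let factor f use the edges (g , k) (g + d_k f , k + 1): these factors partition
-- the edges, and the cycles of f have length n times the order of s_f = Σ_k d_k f.
-- As the Sylow 2-subgroup of G is not cyclic, G has an automorphism ψ with id + ψ also
-- bijective; this lets the first three differences add up to P u - u for any permutation P
-- of G (u being the element indexing f) while the remaining ones cancel in pairs. So it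
-- suffices to find P moving sp elements by steps of order 2x and the others by steps of
-- order y. P is assembled from small local cycles on G viewed as 2x columns of 2 × y cells;
-- an odd sp needs one 3-cycle across two columns.
module Submission where

open import Defs
open import Data.Nat as ℕ using (ℕ; zero; suc; _+_; _*_; _∸_; _≤_; _<_; z≤n; s≤s; NonZero; _%_; _/_)
open import Data.Nat.Properties
open import Data.Nat.DivMod using (_mod_; %-distribˡ-+; m%n<n; m<n⇒m%n≡m; n%n≡0; [m+kn]%n≡m%n; m≡m%n+[m/n]*n)
open import Data.Fin as F using (Fin; toℕ; combine; remQuot)
open import Data.Fin.Properties using (toℕ-injective; toℕ-fromℕ<; toℕ<n; remQuot-combine; combine-remQuot; toℕ-combine; toℕ-↑ˡ; toℕ-↑ʳ; +↔⊎; *↔×; all?)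
open import Data.Fin.Patterns
open import Data.Product using (Σ; _×_; _,_; proj₁; proj₂)
open import Data.Product.Algebra using (×-assoc; ×-distribˡ-⊎; ×-distribʳ-⊎)
open import Data.Product.Function.NonDependent.Propositional using (_×-↔_)
open import Data.Sum using (_⊎_; inj₁; inj₂)
open import Data.Sum.Function.Propositional using (_⊎-↔_)
open import Data.Empty using (⊥; ⊥-elim)
open import Data.Unit using (⊤; tt)
open import Relation.Nullary using (¬_; Dec; yes; no)
open import Relation.Nullary.Decidable using (True; toWitness; map′; _×-dec_; _→-dec_)
open import Relation.Binary.Definitions using (DecidableEquality)
import Relation.Unary as U
open import Data.Product.Properties using () renaming (≡-dec to ×-≡-dec)
open import Data.Sum.Properties using () renaming (≡-dec to ⊎-≡-dec)
open import Relation.Binary.PropositionalEquality using (_≡_; _≢_; refl; sym; trans; cong; cong₂; subst; module ≡-Reasoning)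
open import Function using (_∘_)
open import Function.Definitions using (Injective; Bijective)
open import Function.Bundles using (_↔_; Inverse; Bijection; Injection; mk↔ₛ′)
open import Function.Properties.Inverse using (↔⇒⤖; ↔⇒↣)
open import Function.Construct.Composition using (_↔-∘_)
open import Function.Construct.Symmetry using (↔-sym)
open import Function.Construct.Identity using (↔-id)
open import Data.Nat.Tactic.RingSolver using (solve-∀)

open Inverse using (to; from; strictlyInverseˡ; strictlyInverseʳ)

Fin-cast↔ : ∀ {m n} → m ≡ n → Fin m ↔ Fin n
Fin-cast↔ refl = ↔-id _

toℕ-Fin-cast↔ : ∀ {m n} (e : m ≡ n) (i : Fin m) → toℕ (to (Fin-cast↔ e) i) ≡ toℕ i
toℕ-Fin-cast↔ refl i = refl

toℕ-Fin-cast↔⁻ : ∀ {m n} (e : m ≡ n) (i : Fin n) → toℕ (from (Fin-cast↔ e) i) ≡ toℕ i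
toℕ-Fin-cast↔⁻ refl i = refl

↔-injective : ∀ {A B : Set} (i : A ↔ B) → Injective _≡_ _≡_ (to i)
↔-injective i = Injection.injective (↔⇒↣ i)

↔-bijective : ∀ {A B : Set} (i : A ↔ B) → Bijective _≡_ _≡_ (to i)
↔-bijective i = Bijection.bijective (↔⇒⤖ i)

toℕ-mod : ∀ a m .{{_ : NonZero m}} → toℕ (a mod m) ≡ a % m
toℕ-mod a m = toℕ-fromℕ< (m%n<n a m)

module Residues (m : ℕ) .{{_ : NonZero m}} where

  opaque
    [_] : ℕ → Fin m
    [ a ] = a mod m

    toℕ-[] : ∀ a → toℕ [ a ] ≡ a % m
    toℕ-[] a = toℕ-mod a m

  infixl 6 _⊕_
  _⊕_ : Fin m → Fin m → Fin m
  a ⊕ b = [ toℕ a + toℕ b ]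

  ⊖_ : Fin m → Fin m
  ⊖ a = [ m ∸ toℕ a ]

  𝟎 : Fin m
  𝟎 = [ 0 ]

  []-toℕ : ∀ a → [ toℕ a ] ≡ a
  []-toℕ a = toℕ-injective (trans (toℕ-[] (toℕ a)) (m<n⇒m%n≡m (toℕ<n a)))

  []-+ : ∀ a b → [ a + b ] ≡ [ a ] ⊕ [ b ]
  []-+ a b = toℕ-injective (begin
      toℕ [ a + b ]                    ≡⟨ toℕ-[] (a + b) ⟩
      (a + b) % m                      ≡⟨ %-distribˡ-+ a b m ⟩
      (a % m + b % m) % m              ≡⟨ cong₂ (λ u v → (u + v) % m) (sym (toℕ-[] a)) (sym (toℕ-[] b)) ⟩
      (toℕ [ a ] + toℕ [ b ]) % m      ≡⟨ sym (toℕ-[] _) ⟩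
      toℕ ([ a ] ⊕ [ b ]) ∎)
    where open ≡-Reasoning

  []-+m* : ∀ a k → [ a + m * k ] ≡ [ a ]
  []-+m* a k = toℕ-injective (begin
      toℕ [ a + m * k ]   ≡⟨ toℕ-[] _ ⟩
      (a + m * k) % m     ≡⟨ cong (λ z → (a + z) % m) (*-comm m k) ⟩
      (a + k * m) % m     ≡⟨ [m+kn]%n≡m%n a k m ⟩
      a % m               ≡⟨ sym (toℕ-[] a) ⟩
      toℕ [ a ] ∎)
    where open ≡-Reasoning

  []-≡ : ∀ {p q} k₁ k₂ → p + m * k₁ ≡ q + m * k₂ → [ p ] ≡ [ q ]
  []-≡ {p} {q} k₁ k₂ e = trans (sym ([]-+m* p k₁)) (trans (cong [_] e) ([]-+m* q k₂))

  []-m : [ m ] ≡ 𝟎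
  []-m = trans (cong [_] (sym (*-identityʳ m))) ([]-+m* 0 1)

  ⊕-comm : ∀ a b → a ⊕ b ≡ b ⊕ a
  ⊕-comm a b = cong [_] (+-comm (toℕ a) (toℕ b))

  ⊕-assoc : ∀ a b c → (a ⊕ b) ⊕ c ≡ a ⊕ (b ⊕ c)
  ⊕-assoc a b c = begin
      [ toℕ a + toℕ b ] ⊕ c                 ≡⟨ cong ([ toℕ a + toℕ b ] ⊕_) (sym ([]-toℕ c)) ⟩
      [ toℕ a + toℕ b ] ⊕ [ toℕ c ]         ≡⟨ sym ([]-+ _ _) ⟩
      [ toℕ a + toℕ b + toℕ c ]             ≡⟨ cong [_] (+-assoc (toℕ a) (toℕ b) (toℕ c)) ⟩
      [ toℕ a + (toℕ b + toℕ c) ]           ≡⟨ []-+ _ _ ⟩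
      [ toℕ a ] ⊕ [ toℕ b + toℕ c ]         ≡⟨ cong (_⊕ [ toℕ b + toℕ c ]) ([]-toℕ a) ⟩
      a ⊕ (b ⊕ c) ∎
    where open ≡-Reasoning

  ⊕-identityʳ : ∀ a → a ⊕ 𝟎 ≡ a
  ⊕-identityʳ a = begin
      a ⊕ 𝟎                  ≡⟨ cong (_⊕ 𝟎) (sym ([]-toℕ a)) ⟩
      [ toℕ a ] ⊕ [ 0 ]      ≡⟨ sym ([]-+ (toℕ a) 0) ⟩
      [ toℕ a + 0 ]          ≡⟨ cong [_] (+-identityʳ (toℕ a)) ⟩
      [ toℕ a ]              ≡⟨ []-toℕ a ⟩
      a ∎
    where open ≡-Reasoning

  ⊕-inverseʳ : ∀ a → a ⊕ ⊖ a ≡ 𝟎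
  ⊕-inverseʳ a = begin
      a ⊕ ⊖ a                          ≡⟨ cong (_⊕ ⊖ a) (sym ([]-toℕ a)) ⟩
      [ toℕ a ] ⊕ [ m ∸ toℕ a ]        ≡⟨ sym ([]-+ _ _) ⟩
      [ toℕ a + (m ∸ toℕ a) ]          ≡⟨ cong [_] (m+[n∸m]≡n (<⇒≤ (toℕ<n a))) ⟩
      [ m ]                            ≡⟨ []-m ⟩
      𝟎 ∎
    where open ≡-Reasoning

  []-linear-% : ∀ c t s m₁ .{{_ : NonZero m₁}} q → c * m₁ ≡ m * q →
                [ c * (t % m₁) + s ] ≡ [ c * t + s ]
  []-linear-% c t s m₁ q e = begin
      [ c * (t % m₁) + s ]                          ≡⟨ sym ([]-+m* _ (q * (t / m₁))) ⟩
      [ c * (t % m₁) + s + m * (q * (t / m₁)) ]     ≡⟨ cong [_] (shuffle (t % m₁) (t / m₁)) ⟩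
      [ c * (t % m₁ + t / m₁ * m₁) + s ]            ≡⟨ cong (λ z → [ c * z + s ]) (sym (m≡m%n+[m/n]*n t m₁)) ⟩
      [ c * t + s ] ∎
    where
    open ≡-Reasoning
    shuffle : ∀ r d → c * r + s + m * (q * d) ≡ c * (r + d * m₁) + s
    shuffle r d = begin
      c * r + s + m * (q * d)      ≡⟨ cong (c * r + s +_) (trans (sym (*-assoc m q d)) (cong (_* d) (sym e))) ⟩
      c * r + s + c * m₁ * d       ≡⟨ ring c r s (c * m₁) d ⟩
      c * r + c * m₁ * d + s       ≡⟨ cong (λ z → c * r + z + s) (trans (*-assoc c m₁ d) (cong (c *_) (*-comm m₁ d))) ⟩
      c * r + c * (d * m₁) + s     ≡⟨ cong (_+ s) (sym (*-distribˡ-+ c r (d * m₁))) ⟩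
      c * (r + d * m₁) + s ∎
      where
      ring : ∀ c r s u d → c * r + s + u * d ≡ c * r + u * d + s
      ring = solve-∀

  []-linear-toℕ : ∀ c t s → [ c * toℕ [ t ] + s ] ≡ [ c * t + s ]
  []-linear-toℕ c t s = trans (cong (λ z → [ c * z + s ]) (toℕ-[] t)) ([]-linear-% c t s m c (*-comm c m))

record AbGroup : Set₁ where
  infixl 6 _⊹_
  field
    C       : Set
    _⊹_     : C → C → C
    ⊟_      : C → C
    ε       : C
    ⊹-assoc : ∀ a b c → (a ⊹ b) ⊹ c ≡ a ⊹ (b ⊹ c)
    ⊹-comm  : ∀ a b → a ⊹ b ≡ b ⊹ a
    ⊹-identityʳ : ∀ a → a ⊹ ε ≡ a
    ⊹-inverseʳ  : ∀ a → a ⊹ ⊟ a ≡ ε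

  ⊹-identityˡ : ∀ a → ε ⊹ a ≡ a
  ⊹-identityˡ a = trans (⊹-comm ε a) (⊹-identityʳ a)

  ⊹-inverseˡ : ∀ a → ⊟ a ⊹ a ≡ ε
  ⊹-inverseˡ a = trans (⊹-comm (⊟ a) a) (⊹-inverseʳ a)

  ⊹-⊟-cancel : ∀ a b → (a ⊹ b) ⊹ ⊟ b ≡ a
  ⊹-⊟-cancel a b = trans (⊹-assoc a b (⊟ b)) (trans (cong (a ⊹_) (⊹-inverseʳ b)) (⊹-identityʳ a))

  ⊟-⊹-cancel : ∀ a b → (a ⊹ ⊟ b) ⊹ b ≡ a
  ⊟-⊹-cancel a b = trans (⊹-assoc a (⊟ b) b) (trans (cong (a ⊹_) (⊹-inverseˡ b)) (⊹-identityʳ a))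

  ⊹-cancelʳ : ∀ {a b} c → a ⊹ c ≡ b ⊹ c → a ≡ b
  ⊹-cancelʳ {a} {b} c e = trans (sym (⊹-⊟-cancel a c)) (trans (cong (_⊹ ⊟ c) e) (⊹-⊟-cancel b c))

  ⊹-cancelˡ : ∀ {a b} c → c ⊹ a ≡ c ⊹ b → a ≡ b
  ⊹-cancelˡ {a} {b} c e = ⊹-cancelʳ c (trans (⊹-comm a c) (trans e (⊹-comm c b)))

  ⊹-difference : ∀ a b → a ⊹ (b ⊹ ⊟ a) ≡ b
  ⊹-difference a b = trans (⊹-comm a (b ⊹ ⊟ a)) (⊟-⊹-cancel b a)

  ⊟-unique : ∀ a b → a ⊹ b ≡ ε → ⊟ a ≡ b
  ⊟-unique a b e = ⊹-cancelˡ a (trans (⊹-inverseʳ a) (sym e))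

  ⊟-involutive : ∀ a → ⊟ (⊟ a) ≡ a
  ⊟-involutive a = ⊟-unique (⊟ a) a (⊹-inverseˡ a)

  ⊟-distrib-⊹ : ∀ a b → ⊟ (a ⊹ b) ≡ ⊟ a ⊹ ⊟ b
  ⊟-distrib-⊹ a b = ⊟-unique (a ⊹ b) (⊟ a ⊹ ⊟ b) (begin
    (a ⊹ b) ⊹ (⊟ a ⊹ ⊟ b)     ≡⟨ cong (_⊹ (⊟ a ⊹ ⊟ b)) (⊹-comm a b) ⟩
    (b ⊹ a) ⊹ (⊟ a ⊹ ⊟ b)     ≡⟨ ⊹-assoc b a _ ⟩
    b ⊹ (a ⊹ (⊟ a ⊹ ⊟ b))     ≡⟨ cong (b ⊹_) (sym (⊹-assoc a (⊟ a) (⊟ b))) ⟩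
    b ⊹ ((a ⊹ ⊟ a) ⊹ ⊟ b)     ≡⟨ cong (λ z → b ⊹ (z ⊹ ⊟ b)) (⊹-inverseʳ a) ⟩
    b ⊹ (ε ⊹ ⊟ b)             ≡⟨ cong (b ⊹_) (⊹-identityˡ (⊟ b)) ⟩
    b ⊹ ⊟ b                   ≡⟨ ⊹-inverseʳ b ⟩
    ε ∎)
    where open ≡-Reasoning

record Automorphism (A : AbGroup) : Set where
  open AbGroup A
  field
    perm     : C ↔ C
    additive : ∀ g h → to perm (g ⊹ h) ≡ to perm g ⊹ to perm h

module _ {A : AbGroup} where
  open AbGroup A
  open Automorphism

  id-automorphism : Automorphism A
  id-automorphism = record { perm = ↔-id _ ; additive = λ _ _ → refl }

  ⊟-automorphism : Automorphism A
  ⊟-automorphism = record { perm = mk↔ₛ′ ⊟_ ⊟_ ⊟-involutive ⊟-involutive ; additive = ⊟-distrib-⊹ }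

  _∘ᴬ_ : Automorphism A → Automorphism A → Automorphism A
  α ∘ᴬ β = record
    { perm     = perm α ↔-∘ perm β
    ; additive = λ g h → trans (cong (to (perm α)) (additive β g h)) (additive α _ _)
    }

ℤ/ : (m : ℕ) .{{_ : NonZero m}} → AbGroup
ℤ/ m = record
  { C = Fin m ; _⊹_ = _⊕_ ; ⊟_ = ⊖_ ; ε = 𝟎
  ; ⊹-assoc = ⊕-assoc ; ⊹-comm = ⊕-comm ; ⊹-identityʳ = ⊕-identityʳ ; ⊹-inverseʳ = ⊕-inverseʳ }
  where open Residues m

_×ᴳ_ : AbGroup → AbGroup → AbGroup
A ×ᴳ B = record
  { C = A.C × B.C
  ; _⊹_ = λ { (a , b) (a′ , b′) → a A.⊹ a′ , b B.⊹ b′ }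
  ; ⊟_ = λ { (a , b) → A.⊟ a , B.⊟ b }
  ; ε = A.ε , B.ε
  ; ⊹-assoc = λ { (a , b) (a′ , b′) (a″ , b″) → cong₂ _,_ (A.⊹-assoc a a′ a″) (B.⊹-assoc b b′ b″) }
  ; ⊹-comm = λ { (a , b) (a′ , b′) → cong₂ _,_ (A.⊹-comm a a′) (B.⊹-comm b b′) }
  ; ⊹-identityʳ = λ { (a , b) → cong₂ _,_ (A.⊹-identityʳ a) (B.⊹-identityʳ b) }
  ; ⊹-inverseʳ = λ { (a , b) → cong₂ _,_ (A.⊹-inverseʳ a) (B.⊹-inverseʳ b) }
  }
  where
  module A = AbGroup A
  module B = AbGroup B

toℕ-next : ∀ {ℓ} (i : Fin ℓ) → suc (toℕ i) < ℓ → toℕ (next i) ≡ suc (toℕ i)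
toℕ-next {suc m} i lt = trans (toℕ-mod (suc (toℕ i)) (suc m)) (m<n⇒m%n≡m lt)

toℕ-next-last : ∀ {ℓ} (i : Fin ℓ) → suc (toℕ i) ≡ ℓ → toℕ (next i) ≡ 0
toℕ-next-last {suc m} i e = trans (toℕ-mod (suc (toℕ i)) (suc m)) (trans (cong (_% suc m) e) (n%n≡0 (suc m)))

next-unique : ∀ {ℓ} (i j : Fin ℓ) → suc (toℕ i) ≡ toℕ j → next i ≡ j
next-unique {ℓ} i j e = toℕ-injective (trans (toℕ-next i (subst (_< ℓ) (sym e) (toℕ<n j))) e)

next-unique-last : ∀ {ℓ} (i j : Fin ℓ) → suc (toℕ i) ≡ ℓ → toℕ j ≡ 0 → next i ≡ j
next-unique-last i j e j≡0 = toℕ-injective (trans (toℕ-next-last i e) (sym j≡0))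

next≡⊕1 : ∀ {m} (i : Fin (suc m)) → next i ≡ Residues._⊕_ (suc m) i (Residues.[_] (suc m) 1)
next≡⊕1 {m} i = toℕ-injective (begin
    toℕ (next i)              ≡⟨ toℕ-mod (suc (toℕ i)) (suc m) ⟩
    suc (toℕ i) % suc m       ≡⟨ cong (_% suc m) (+-comm 1 (toℕ i)) ⟩
    (toℕ i + 1) % suc m       ≡⟨ sym (toℕ-[] _) ⟩
    toℕ [ toℕ i + 1 ]         ≡⟨ cong toℕ ([]-+ (toℕ i) 1) ⟩
    toℕ ([ toℕ i ] ⊕ [ 1 ])   ≡⟨ cong (λ z → toℕ (z ⊕ [ 1 ])) ([]-toℕ i) ⟩
    toℕ (i ⊕ [ 1 ]) ∎)
  where open ≡-Reasoning; open Residues (suc m)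

next∘next≢id : ∀ {n} → 3 ≤ n → (i : Fin n) → next (next i) ≢ i
next∘next≢id {suc m} 3≤n i eq = 2≢0 (begin
    2                ≡⟨ sym (m<n⇒m%n≡m 3≤n) ⟩
    2 % suc m        ≡⟨ sym (toℕ-[] 2) ⟩
    toℕ [ 2 ]        ≡⟨ cong toℕ ([2]≡𝟎) ⟩
    toℕ 𝟎            ≡⟨ toℕ-[] 0 ⟩
    0 ∎)
  where
  open ≡-Reasoning
  open Residues (suc m)
  open AbGroup (ℤ/ (suc m)) using (⊹-cancelˡ)
  2≢0 : 2 ≢ 0
  2≢0 ()
  [2]≡𝟎 : [ 2 ] ≡ 𝟎
  [2]≡𝟎 = ⊹-cancelˡ i (begin
    i ⊕ [ 2 ]               ≡⟨ cong (i ⊕_) ([]-+ 1 1) ⟩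
    i ⊕ ([ 1 ] ⊕ [ 1 ])     ≡⟨ sym (⊕-assoc i [ 1 ] [ 1 ]) ⟩
    (i ⊕ [ 1 ]) ⊕ [ 1 ]     ≡⟨ sym (trans (next≡⊕1 (next i)) (cong (_⊕ [ 1 ]) (next≡⊕1 i))) ⟩
    next (next i)           ≡⟨ eq ⟩
    i                       ≡⟨ sym (⊕-identityʳ i) ⟩
    i ⊕ 𝟎 ∎)

-- In Fin (mm * n) ≅ Fin mm × Fin n the successor is a two-digit counter:
-- the low digit i advances and carries into the high digit q at i = n - 1.
carry : ∀ {mm n} → Fin mm → Fin n → Fin mm
carry {n = n} q i with suc (toℕ i) ℕ.<? n
... | yes _ = q
... | no  _ = next q

≮⇒last : ∀ {ℓ} (i : Fin ℓ) → ¬ suc (toℕ i) < ℓ → suc (toℕ i) ≡ ℓ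
≮⇒last i i+1≮ℓ = ≤-antisym (toℕ<n i) (≮⇒≥ i+1≮ℓ)

suc-combine-last : ∀ {mm n} (q : Fin mm) (i : Fin n) → suc (toℕ i) ≡ n →
                   suc (toℕ (combine q i)) ≡ n * suc (toℕ q)
suc-combine-last {n = n} q i i-last = begin
    suc (toℕ (combine q i))   ≡⟨ cong suc (toℕ-combine q i) ⟩
    suc (n * toℕ q + toℕ i)   ≡⟨ sym (+-suc (n * toℕ q) (toℕ i)) ⟩
    n * toℕ q + suc (toℕ i)   ≡⟨ cong (n * toℕ q +_) i-last ⟩
    n * toℕ q + n             ≡⟨ +-comm (n * toℕ q) n ⟩
    n + n * toℕ q             ≡⟨ sym (*-suc n (toℕ q)) ⟩
    n * suc (toℕ q) ∎
  where open ≡-Reasoning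

next-combine : ∀ {mm n} (q : Fin mm) (i : Fin n) → next (combine q i) ≡ combine (carry q i) (next i)
next-combine {mm} {n} q i with suc (toℕ i) ℕ.<? n
... | yes i+1<n = next-unique _ _ (begin
      suc (toℕ (combine q i))     ≡⟨ cong suc (toℕ-combine q i) ⟩
      suc (n * toℕ q + toℕ i)     ≡⟨ sym (+-suc (n * toℕ q) (toℕ i)) ⟩
      n * toℕ q + suc (toℕ i)     ≡⟨ cong (n * toℕ q +_) (sym (toℕ-next i i+1<n)) ⟩
      n * toℕ q + toℕ (next i)    ≡⟨ sym (toℕ-combine q (next i)) ⟩
      toℕ (combine q (next i)) ∎)
  where open ≡-Reasoning
... | no i+1≮n with suc (toℕ q) ℕ.<? mm
...   | yes q+1<mm = next-unique _ _ (begin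
      suc (toℕ (combine q i))         ≡⟨ suc-combine-last q i (≮⇒last i i+1≮n) ⟩
      n * suc (toℕ q)                 ≡⟨ sym (+-identityʳ _) ⟩
      n * suc (toℕ q) + 0             ≡⟨ cong₂ (λ a b → n * a + b) (sym (toℕ-next q q+1<mm)) (sym (toℕ-next-last i (≮⇒last i i+1≮n))) ⟩
      n * toℕ (next q) + toℕ (next i) ≡⟨ sym (toℕ-combine (next q) (next i)) ⟩
      toℕ (combine (next q) (next i)) ∎)
  where open ≡-Reasoning
...   | no q+1≮mm = next-unique-last _ _ wraps (begin
      toℕ (combine (next q) (next i))    ≡⟨ toℕ-combine (next q) (next i) ⟩
      n * toℕ (next q) + toℕ (next i)    ≡⟨ cong₂ (λ a b → n * a + b) (toℕ-next-last q (≮⇒last q q+1≮mm)) (toℕ-next-last i (≮⇒last i i+1≮n)) ⟩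
      n * 0 + 0                          ≡⟨ cong (_+ 0) (*-zeroʳ n) ⟩
      0 ∎)
  where
  open ≡-Reasoning
  wraps : suc (toℕ (combine q i)) ≡ mm * n
  wraps = trans (suc-combine-last q i (≮⇒last i i+1≮n)) (trans (cong (n *_) (≮⇒last q q+1≮mm)) (*-comm n mm))

remQuot-next : ∀ {mm n} (p : Fin (mm * n)) →
  remQuot {mm} n (next p) ≡ (carry (proj₁ (remQuot {mm} n p)) (proj₂ (remQuot {mm} n p)) , next (proj₂ (remQuot {mm} n p)))
remQuot-next {mm} {n} p = begin
    remQuot n (next p)                     ≡⟨ cong (remQuot n ∘ next) (sym (combine-remQuot {mm} n p)) ⟩
    remQuot n (next (combine q i))         ≡⟨ cong (remQuot n) (next-combine q i) ⟩
    remQuot n (combine (carry q i) (next i)) ≡⟨ remQuot-combine (carry q i) (next i) ⟩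
    (carry q i , next i) ∎
  where
  open ≡-Reasoning
  q = proj₁ (remQuot {mm} n p)
  i = proj₂ (remQuot {mm} n p)

module LayeredDecomposition
  (A : AbGroup) (v n : ℕ) (n≥3 : 3 ≤ n) (enc : AbGroup.C A ↔ Fin v)
  (I : Set) (len order cosets : I → ℕ) (len≡ : ∀ f → len f ≡ order f * n)
  (diff : ℕ → I ↔ AbGroup.C A)
  where
  open AbGroup A

  partialSum : I → ℕ → C
  partialSum f zero    = ε
  partialSum f (suc k) = partialSum f k ⊹ to (diff k) f

  -- A walk of factor f returns to layer 0 shifted by partialSum f n; orbit f
  -- enumerates the group along the cosets of the subgroup this shift generates.
  module _ (orbit : ∀ f → (Fin (cosets f) × Fin (order f)) ↔ C)
           (orbit-step : ∀ f a q → to (orbit f) (a , next q) ≡ to (orbit f) (a , q) ⊹ partialSum f n) where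

    lap×layer : ∀ f → Fin (len f) ↔ (Fin (order f) × Fin n)
    lap×layer f = *↔× {order f} {n} ↔-∘ Fin-cast↔ (len≡ f)

    lap×layer-next : ∀ f (p : Fin (len f)) →
      to (lap×layer f) (next p) ≡ (carry (proj₁ (to (lap×layer f) p)) (proj₂ (to (lap×layer f) p)) , next (proj₂ (to (lap×layer f) p)))
    lap×layer-next f p = trans (cong (remQuot n) (next-Fin-cast↔ (len≡ f) p)) (remQuot-next (to (Fin-cast↔ (len≡ f)) p))
      where
      next-Fin-cast↔ : ∀ {ℓ ℓ′} (e : ℓ ≡ ℓ′) (i : Fin ℓ) → to (Fin-cast↔ e) (next i) ≡ next (to (Fin-cast↔ e) i)
      next-Fin-cast↔ refl i = refl

    layer : ∀ f → Fin (len f) → Fin n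
    layer f p = proj₂ (to (lap×layer f) p)

    layer-next : ∀ f p → layer f (next p) ≡ next (layer f p)
    layer-next f p = cong proj₂ (lap×layer-next f p)

    vertex : ∀ f → Fin (cosets f) → Fin (len f) → C
    vertex f a p = to (orbit f) (a , proj₁ (to (lap×layer f) p)) ⊹ partialSum f (toℕ (layer f p))

    vertex-next : ∀ f a p → vertex f a (next p) ≡ vertex f a p ⊹ to (diff (toℕ (layer f p))) f
    vertex-next f a p = trans (cong step (lap×layer-next f p)) (carry-step (proj₁ (to (lap×layer f) p)) (layer f p))
      where
      step : Fin (order f) × Fin n → C
      step (q , i) = to (orbit f) (a , q) ⊹ partialSum f (toℕ i)
      carry-step : (q : Fin (order f)) (i : Fin n) →
        to (orbit f) (a , carry q i) ⊹ partialSum f (toℕ (next i)) ≡ (to (orbit f) (a , q) ⊹ partialSum f (toℕ i)) ⊹ to (diff (toℕ i)) f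
      carry-step q i with suc (toℕ i) ℕ.<? n
      ... | yes i+1<n = trans (cong (λ z → to (orbit f) (a , q) ⊹ partialSum f z) (toℕ-next i i+1<n)) (sym (⊹-assoc _ _ _))
      ... | no i+1≮n = begin
          to (orbit f) (a , next q) ⊹ partialSum f (toℕ (next i))  ≡⟨ cong (λ z → to (orbit f) (a , next q) ⊹ partialSum f z) (toℕ-next-last i (≮⇒last i i+1≮n)) ⟩
          to (orbit f) (a , next q) ⊹ ε                            ≡⟨ ⊹-identityʳ _ ⟩
          to (orbit f) (a , next q)                                ≡⟨ orbit-step f a q ⟩
          to (orbit f) (a , q) ⊹ partialSum f n                    ≡⟨ cong (λ z → to (orbit f) (a , q) ⊹ partialSum f z) (sym (≮⇒last i i+1≮n)) ⟩
          to (orbit f) (a , q) ⊹ partialSum f (suc (toℕ i))        ≡⟨ sym (⊹-assoc _ _ _) ⟩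
          (to (orbit f) (a , q) ⊹ partialSum f (toℕ i)) ⊹ to (diff (toℕ i)) f ∎
        where open ≡-Reasoning

    vertex↔ : ∀ f → ((Fin (cosets f) × Fin (order f)) × Fin n) ↔ (C × Fin n)
    vertex↔ f = mk↔ₛ′ (λ { (w , i) → to (orbit f) w ⊹ partialSum f (toℕ i) , i })
                      (λ { (g , i) → from (orbit f) (g ⊹ ⊟ partialSum f (toℕ i)) , i })
                      (λ { (g , i) → cong (_, i) (trans (cong (_⊹ partialSum f (toℕ i)) (strictlyInverseˡ (orbit f) _)) (⊟-⊹-cancel g _)) })
                      (λ { (w , i) → cong (_, i) (trans (cong (from (orbit f)) (⊹-⊟-cancel _ _)) (strictlyInverseʳ (orbit f) w)) })

    cycles↔ : ∀ f → (Fin (cosets f) × Fin (len f)) ↔ Vtx v n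
    cycles↔ f = (enc ×-↔ ↔-id _) ↔-∘ (vertex↔ f ↔-∘ (↔-sym (×-assoc _ _ _ _) ↔-∘ (↔-id _ ×-↔ lap×layer f)))

    cycleFactor : ∀ f → CycleFactor (Vtx v n) Adj (len f)
    cycleFactor f = record
      { t     = cosets f
      ; cyc   = λ a p → to (cycles↔ f) (a , p)
      ; bij   = ↔-bijective (cycles↔ f)
      ; edges = λ a p → inj₁ (layer-next f p)
      }

    Occurrence : Set
    Occurrence = Σ I λ f → Fin (cosets f) × Fin (len f)

    endpoints : Occurrence → Vtx v n × Vtx v n
    endpoints (f , a , p) = to (cycles↔ f) (a , p) , to (cycles↔ f) (a , next p)

    endpoint₂ : ∀ f a p → proj₂ (endpoints (f , a , p)) ≡ (to enc (vertex f a p ⊹ to (diff (toℕ (layer f p))) f) , next (layer f p))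
    endpoint₂ f a p = cong₂ _,_ (cong (to enc) (vertex-next f a p)) (layer-next f p)

    -- The edge (g , i) (h , next i) is used by the factor f with diff i f = h - g.
    occurrence-of-edge : ∀ g i h j → j ≡ next i → Σ Occurrence λ o → endpoints o ≡ ((g , i) , (h , j))
    occurrence-of-edge g i h j j≡ = (f , a , p) , cong₂ _,_ first second
      where
      f : I
      f = from (diff (toℕ i)) (from enc h ⊹ ⊟ from enc g)
      w : Fin (cosets f) × Fin (order f)
      w = from (orbit f) (from enc g ⊹ ⊟ partialSum f (toℕ i))
      a = proj₁ w
      p : Fin (len f)
      p = from (lap×layer f) (proj₂ w , i)
      at-p : to (lap×layer f) p ≡ (proj₂ w , i)
      at-p = strictlyInverseˡ (lap×layer f) _
      layer≡ : layer f p ≡ i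
      layer≡ = cong proj₂ at-p
      vertex≡ : vertex f a p ≡ from enc g
      vertex≡ = begin
        vertex f a p                                   ≡⟨ cong (λ z → to (orbit f) (a , proj₁ z) ⊹ partialSum f (toℕ (proj₂ z))) at-p ⟩
        to (orbit f) w ⊹ partialSum f (toℕ i)          ≡⟨ cong (_⊹ partialSum f (toℕ i)) (strictlyInverseˡ (orbit f) _) ⟩
        (from enc g ⊹ ⊟ partialSum f (toℕ i)) ⊹ partialSum f (toℕ i) ≡⟨ ⊟-⊹-cancel _ _ ⟩
        from enc g ∎
        where open ≡-Reasoning
      first : to (cycles↔ f) (a , p) ≡ (g , i)
      first = cong₂ _,_ (trans (cong (to enc) vertex≡) (strictlyInverseˡ enc g)) layer≡
      next-vertex≡ : vertex f a p ⊹ to (diff (toℕ (layer f p))) f ≡ from enc h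
      next-vertex≡ = begin
        vertex f a p ⊹ to (diff (toℕ (layer f p))) f     ≡⟨ cong₂ (λ u z → u ⊹ to (diff (toℕ z)) f) vertex≡ layer≡ ⟩
        from enc g ⊹ to (diff (toℕ i)) f                 ≡⟨ cong (from enc g ⊹_) (strictlyInverseˡ (diff (toℕ i)) _) ⟩
        from enc g ⊹ (from enc h ⊹ ⊟ from enc g)         ≡⟨ ⊹-difference _ _ ⟩
        from enc h ∎
        where open ≡-Reasoning
      second : to (cycles↔ f) (a , next p) ≡ (h , j)
      second = trans (endpoint₂ f a p)
        (cong₂ _,_ (trans (cong (to enc) next-vertex≡) (strictlyInverseˡ enc h)) (trans (cong next layer≡) (sym j≡)))

    -- The first endpoint fixes the vertex and layer, the second then fixes the
    -- difference and hence the factor; within a factor the cycle enumeration is injective.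
    endpoints-injective : ∀ o o′ → endpoints o ≡ endpoints o′ → o ≡ o′
    endpoints-injective (f , a , p) (f′ , a′ , p′) e = same-factor f′ a′ p′ f≡ (cong proj₁ e)
      where
      vertex≡ : vertex f a p ≡ vertex f′ a′ p′
      vertex≡ = ↔-injective enc (cong (proj₁ ∘ proj₁) e)
      layer≡ : layer f p ≡ layer f′ p′
      layer≡ = cong (proj₂ ∘ proj₁) e
      step≡ : to enc (vertex f a p ⊹ to (diff (toℕ (layer f p))) f) ≡ to enc (vertex f′ a′ p′ ⊹ to (diff (toℕ (layer f′ p′))) f′)
      step≡ = cong proj₁ (trans (sym (endpoint₂ f a p)) (trans (cong proj₂ e) (endpoint₂ f′ a′ p′)))
      f≡ : f ≡ f′
      f≡ = ↔-injective (diff (toℕ (layer f p))) (⊹-cancelˡ (vertex f a p)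
             (trans (↔-injective enc step≡) (cong₂ (λ u z → u ⊹ to (diff (toℕ z)) f′) (sym vertex≡) (sym layer≡))))
      same-factor : ∀ f′ a′ p′ → f ≡ f′ → proj₁ (endpoints (f , a , p)) ≡ proj₁ (endpoints (f′ , a′ , p′)) → (f , a , p) ≡ (f′ , a′ , p′)
      same-factor .f a′ p′ refl e₁ = cong (f ,_) (cong₂ _,_ (cong proj₁ lap≡) (↔-injective (lap×layer f) (cong₂ _,_ (cong proj₂ lap≡) (cong proj₂ e₁))))
        where
        lap≡ : (a , proj₁ (to (lap×layer f) p)) ≡ (a′ , proj₁ (to (lap×layer f) p′))
        lap≡ = ↔-injective (orbit f) (⊹-cancelʳ (partialSum f (toℕ (layer f p)))
                 (trans (↔-injective enc (cong proj₁ e₁)) (cong (λ z → _ ⊹ partialSum f (toℕ z)) (sym (cong proj₂ e₁)))))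

    -- An edge cannot occur in both directions: that would need next (next i) ≡ i, impossible for n ≥ 3.
    endpoints-not-reversed : ∀ o o′ → proj₁ (endpoints o) ≡ proj₂ (endpoints o′) → proj₂ (endpoints o) ≡ proj₁ (endpoints o′) → ⊥
    endpoints-not-reversed (f , a , p) (f′ , a′ , p′) e₁ e₂ =
      next∘next≢id n≥3 (layer f p) (sym (trans l₁ (cong next l₂)))
      where
      l₁ : layer f p ≡ next (layer f′ p′)
      l₁ = trans (cong proj₂ e₁) (cong proj₂ (endpoint₂ f′ a′ p′))
      l₂ : layer f′ p′ ≡ next (layer f p)
      l₂ = sym (trans (sym (cong proj₂ (endpoint₂ f a p))) (cong proj₂ e₂))

    decomposition : Decomposition (Vtx v n) Adj I len
    decomposition = record { factor = cycleFactor ; cover = cover ; unique = unique }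
      where
      cover : ∀ u w → Adj u w → Σ Occurrence λ o → SameEdge u w (proj₁ (endpoints o)) (proj₂ (endpoints o))
      cover (g , i) (h , j) (inj₁ e) with o , eo ← occurrence-of-edge g i h j e =
        o , inj₁ (sym (cong proj₁ eo) , sym (cong proj₂ eo))
      cover (g , i) (h , j) (inj₂ e) with o , eo ← occurrence-of-edge h j g i e =
        o , inj₂ (sym (cong proj₂ eo) , sym (cong proj₁ eo))
      unique : ∀ u w (o o′ : Occurrence) → SameEdge u w (proj₁ (endpoints o)) (proj₂ (endpoints o)) →
               SameEdge u w (proj₁ (endpoints o′)) (proj₂ (endpoints o′)) → o ≡ o′
      unique u w o o′ (inj₁ (a₁ , b₁)) (inj₁ (a₂ , b₂)) = endpoints-injective o o′ (cong₂ _,_ (trans (sym a₁) a₂) (trans (sym b₁) b₂))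
      unique u w o o′ (inj₂ (a₁ , b₁)) (inj₂ (a₂ , b₂)) = endpoints-injective o o′ (cong₂ _,_ (trans (sym b₁) b₂) (trans (sym a₁) a₂))
      unique u w o o′ (inj₁ (a₁ , b₁)) (inj₂ (a₂ , b₂)) = ⊥-elim (endpoints-not-reversed o o′ (trans (sym a₁) a₂) (trans (sym b₁) b₂))
      unique u w o o′ (inj₂ (a₁ , b₁)) (inj₁ (a₂ , b₂)) = ⊥-elim (endpoints-not-reversed o o′ (trans (sym b₁) b₂) (trans (sym a₁) a₂))

-- Component identities for the inverse pairs among the automorphisms of ℤ₂ × ℤ₂ₓ × ℤ_y below,
-- written x = 1 + 2 jx and y = 1 + 2 jy, each with its quotient made explicit.
ψψ⁻¹-ℤ₂ : ∀ jx a b → 0 * (1 * a + 1 * b) + 1 * (suc (2 * jx) * 1 * a + (1 + suc (2 * jx)) * b) + 2 * 0 ≡ a + 2 * (b + jx * b + jx * a)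
ψψ⁻¹-ℤ₂ = solve-∀
ψψ⁻¹-ℤ₂ₓ : ∀ jx a b → suc (2 * jx) * 1 * (1 * a + 1 * b) + 1 * (suc (2 * jx) * 1 * a + (1 + suc (2 * jx)) * b) + 2 * suc (2 * jx) * 0 ≡ b + 2 * suc (2 * jx) * (b + a)
ψψ⁻¹-ℤ₂ₓ = solve-∀
ψ⁻¹ψ-ℤ₂ : ∀ jx a b → 1 * (0 * a + 1 * b) + 1 * (suc (2 * jx) * 1 * a + 1 * b) + 2 * 0 ≡ a + 2 * (b + jx * a)
ψ⁻¹ψ-ℤ₂ = solve-∀
ψ⁻¹ψ-ℤ₂ₓ : ∀ jx a b → suc (2 * jx) * 1 * (0 * a + 1 * b) + (1 + suc (2 * jx)) * (suc (2 * jx) * 1 * a + 1 * b) + 2 * suc (2 * jx) * 0 ≡ b + 2 * suc (2 * jx) * (b + a + jx * a)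
ψ⁻¹ψ-ℤ₂ₓ = solve-∀
FF⁻¹-ℤ₂ : ∀ jx a b → 1 * (0 * a + 1 * b) + 1 * (suc (2 * jx) * 1 * a + (suc jx + suc (2 * jx) * jx) * b) + 2 * 0 ≡ a + 2 * (b + jx * b + jx * a + jx * jx * b)
FF⁻¹-ℤ₂ = solve-∀
FF⁻¹-ℤ₂ₓ : ∀ jx a b → suc (2 * jx) * 1 * (0 * a + 1 * b) + 2 * (suc (2 * jx) * 1 * a + (suc jx + suc (2 * jx) * jx) * b) + 2 * suc (2 * jx) * 0 ≡ b + 2 * suc (2 * jx) * (b + a + jx * b)
FF⁻¹-ℤ₂ₓ = solve-∀
FF⁻¹-ℤy : ∀ jy c → 2 * (suc jy * c) + suc (2 * jy) * 0 ≡ c + suc (2 * jy) * c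
FF⁻¹-ℤy = solve-∀
F⁻¹F-ℤ₂ : ∀ jx a b → 0 * (1 * a + 1 * b) + 1 * (suc (2 * jx) * 1 * a + 2 * b) + 2 * 0 ≡ a + 2 * (b + jx * a)
F⁻¹F-ℤ₂ = solve-∀
F⁻¹F-ℤ₂ₓ : ∀ jx a b → suc (2 * jx) * 1 * (1 * a + 1 * b) + (suc jx + suc (2 * jx) * jx) * (suc (2 * jx) * 1 * a + 2 * b) + 2 * suc (2 * jx) * 0 ≡ b + 2 * suc (2 * jx) * (b + a + jx * b + jx * a + jx * jx * a)
F⁻¹F-ℤ₂ₓ = solve-∀
F⁻¹F-ℤy : ∀ jy c → suc jy * (2 * c) + suc (2 * jy) * 0 ≡ c + suc (2 * jy) * c
F⁻¹F-ℤy = solve-∀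
shear²-ℤ₂ : ∀ jx a b → 1 * (1 * a + 1 * b) + 1 * (suc (2 * jx) * 0 * a + 1 * b) + 2 * 0 ≡ a + 2 * b
shear²-ℤ₂ = solve-∀
shear²-ℤ₂ₓ : ∀ jx a b → suc (2 * jx) * 0 * (1 * a + 1 * b) + 1 * (suc (2 * jx) * 0 * a + 1 * b) + 2 * suc (2 * jx) * 0 ≡ b + 2 * suc (2 * jx) * 0
shear²-ℤ₂ₓ = solve-∀
unit-ℤy : ∀ jy c → 1 * (1 * c) + suc (2 * jy) * 0 ≡ c + suc (2 * jy) * 0
unit-ℤy = solve-∀

module Group (jx jy : ℕ) where
  x y : ℕ
  x = suc (2 * jx)
  y = suc (2 * jy)

  module ℤ₂ = Residues 2
  module ℤ₂ₓ = Residues (2 * x)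
  module ℤy = Residues y

  G : AbGroup
  G = ℤ/ 2 ×ᴳ (ℤ/ (2 * x) ×ᴳ ℤ/ y)
  open AbGroup G public

  ⟦_,_,_⟧ : ℕ → ℕ → ℕ → C
  ⟦ a , b , c ⟧ = ℤ₂.[ a ] , ℤ₂ₓ.[ b ] , ℤy.[ c ]

  ⟦⟧-+ : ∀ a b c a′ b′ c′ → ⟦ a + a′ , b + b′ , c + c′ ⟧ ≡ ⟦ a , b , c ⟧ ⊹ ⟦ a′ , b′ , c′ ⟧
  ⟦⟧-+ a b c a′ b′ c′ = cong₂ _,_ (ℤ₂.[]-+ a a′) (cong₂ _,_ (ℤ₂ₓ.[]-+ b b′) (ℤy.[]-+ c c′))

  ⟦⟧-toℕ : ∀ (g : C) → ⟦ toℕ (proj₁ g) , toℕ (proj₁ (proj₂ g)) , toℕ (proj₂ (proj₂ g)) ⟧ ≡ g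
  ⟦⟧-toℕ (b , c , e) = cong₂ _,_ (ℤ₂.[]-toℕ b) (cong₂ _,_ (ℤ₂ₓ.[]-toℕ c) (ℤy.[]-toℕ e))

  ⟦⟧-≡ : ∀ {a b c a′ b′ c′} k₁ k₂ k₃ k₄ k₅ k₆ → a + 2 * k₁ ≡ a′ + 2 * k₂ →
         b + 2 * x * k₃ ≡ b′ + 2 * x * k₄ → c + y * k₅ ≡ c′ + y * k₆ → ⟦ a , b , c ⟧ ≡ ⟦ a′ , b′ , c′ ⟧
  ⟦⟧-≡ k₁ k₂ k₃ k₄ k₅ k₆ e₁ e₂ e₃ = cong₂ _,_ (ℤ₂.[]-≡ k₁ k₂ e₁) (cong₂ _,_ (ℤ₂ₓ.[]-≡ k₃ k₄ e₂) (ℤy.[]-≡ k₅ k₆ e₃))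

  ⟦⟧-cong : ∀ {a b c a′ b′ c′} → a ≡ a′ → b ≡ b′ → c ≡ c′ → ⟦ a , b , c ⟧ ≡ ⟦ a′ , b′ , c′ ⟧
  ⟦⟧-cong refl refl refl = refl

  -- The ℤ₂ coordinate enters the ℤ₂ₓ coordinate through a multiple of x,
  -- the only way a homomorphism ℤ₂ → ℤ₂ₓ can act.
  linear : (α β γ δ κ : ℕ) → C → C
  linear α β γ δ κ (b , c , e) = ⟦ α * toℕ b + β * toℕ c , x * γ * toℕ b + δ * toℕ c , κ * toℕ e ⟧

  linear-⟦⟧ : ∀ α β γ δ κ a b c →
    linear α β γ δ κ ⟦ a , b , c ⟧ ≡ ⟦ α * a + β * b , x * γ * a + δ * b , κ * c ⟧
  linear-⟦⟧ α β γ δ κ a b c = cong₂ _,_ ℤ₂-part (cong₂ _,_ ℤ₂ₓ-part ℤy-part)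
    where
    open ≡-Reasoning
    ℤ₂-part : ℤ₂.[ α * toℕ ℤ₂.[ a ] + β * toℕ ℤ₂ₓ.[ b ] ] ≡ ℤ₂.[ α * a + β * b ]
    ℤ₂-part = begin
      ℤ₂.[ α * toℕ ℤ₂.[ a ] + β * toℕ ℤ₂ₓ.[ b ] ] ≡⟨ ℤ₂.[]-linear-toℕ α a _ ⟩
      ℤ₂.[ α * a + β * toℕ ℤ₂ₓ.[ b ] ]           ≡⟨ cong (λ z → ℤ₂.[ α * a + β * z ]) (ℤ₂ₓ.toℕ-[] b) ⟩
      ℤ₂.[ α * a + β * (b % (2 * x)) ]           ≡⟨ cong ℤ₂.[_] (+-comm (α * a) _) ⟩
      ℤ₂.[ β * (b % (2 * x)) + α * a ]           ≡⟨ ℤ₂.[]-linear-% β b (α * a) (2 * x) (β * x) (solve-β β x) ⟩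
      ℤ₂.[ β * b + α * a ]                       ≡⟨ cong ℤ₂.[_] (+-comm _ (α * a)) ⟩
      ℤ₂.[ α * a + β * b ] ∎
      where
      solve-β : ∀ β x → β * (2 * x) ≡ 2 * (β * x)
      solve-β = solve-∀
    ℤ₂ₓ-part : ℤ₂ₓ.[ x * γ * toℕ ℤ₂.[ a ] + δ * toℕ ℤ₂ₓ.[ b ] ] ≡ ℤ₂ₓ.[ x * γ * a + δ * b ]
    ℤ₂ₓ-part = begin
      ℤ₂ₓ.[ x * γ * toℕ ℤ₂.[ a ] + δ * toℕ ℤ₂ₓ.[ b ] ] ≡⟨ cong (λ z → ℤ₂ₓ.[ x * γ * z + δ * toℕ ℤ₂ₓ.[ b ] ]) (ℤ₂.toℕ-[] a) ⟩
      ℤ₂ₓ.[ x * γ * (a % 2) + δ * toℕ ℤ₂ₓ.[ b ] ]       ≡⟨ ℤ₂ₓ.[]-linear-% (x * γ) a _ 2 γ (solve-γ x γ) ⟩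
      ℤ₂ₓ.[ x * γ * a + δ * toℕ ℤ₂ₓ.[ b ] ]             ≡⟨ cong ℤ₂ₓ.[_] (+-comm (x * γ * a) _) ⟩
      ℤ₂ₓ.[ δ * toℕ ℤ₂ₓ.[ b ] + x * γ * a ]             ≡⟨ ℤ₂ₓ.[]-linear-toℕ δ b _ ⟩
      ℤ₂ₓ.[ δ * b + x * γ * a ]                         ≡⟨ cong ℤ₂ₓ.[_] (+-comm _ (x * γ * a)) ⟩
      ℤ₂ₓ.[ x * γ * a + δ * b ] ∎
      where
      solve-γ : ∀ x γ → x * γ * 2 ≡ 2 * x * γ
      solve-γ = solve-∀
    ℤy-part : ℤy.[ κ * toℕ ℤy.[ c ] ] ≡ ℤy.[ κ * c ]
    ℤy-part = begin
      ℤy.[ κ * toℕ ℤy.[ c ] ]     ≡⟨ cong ℤy.[_] (sym (+-identityʳ _)) ⟩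
      ℤy.[ κ * toℕ ℤy.[ c ] + 0 ] ≡⟨ ℤy.[]-linear-toℕ κ c 0 ⟩
      ℤy.[ κ * c + 0 ]            ≡⟨ cong ℤy.[_] (+-identityʳ _) ⟩
      ℤy.[ κ * c ] ∎

  linear-⊹ : ∀ α β γ δ κ g h → linear α β γ δ κ (g ⊹ h) ≡ linear α β γ δ κ g ⊹ linear α β γ δ κ h
  linear-⊹ α β γ δ κ (b , c , e) (b′ , c′ , e′) = begin
      linear α β γ δ κ ⟦ tb + tb′ , tc + tc′ , te + te′ ⟧
        ≡⟨ linear-⟦⟧ α β γ δ κ _ _ _ ⟩
      ⟦ α * (tb + tb′) + β * (tc + tc′) , x * γ * (tb + tb′) + δ * (tc + tc′) , κ * (te + te′) ⟧
        ≡⟨ ⟦⟧-cong (distrib α β tb tc tb′ tc′) (distrib (x * γ) δ tb tc tb′ tc′) (*-distribˡ-+ κ te te′) ⟩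
      ⟦ (α * tb + β * tc) + (α * tb′ + β * tc′) , (x * γ * tb + δ * tc) + (x * γ * tb′ + δ * tc′) , κ * te + κ * te′ ⟧
        ≡⟨ ⟦⟧-+ _ _ _ _ _ _ ⟩
      linear α β γ δ κ (b , c , e) ⊹ linear α β γ δ κ (b′ , c′ , e′) ∎
    where
    open ≡-Reasoning
    tb = toℕ b ; tc = toℕ c ; te = toℕ e ; tb′ = toℕ b′ ; tc′ = toℕ c′ ; te′ = toℕ e′
    distrib : ∀ p q u w s t → p * (u + s) + q * (w + t) ≡ (p * u + q * w) + (p * s + q * t)
    distrib = solve-∀

  linear-inverse : ∀ α β γ δ κ α′ β′ γ′ δ′ κ′ →
    (∀ a b → ℤ₂.[ α * (α′ * a + β′ * b) + β * (x * γ′ * a + δ′ * b) ] ≡ ℤ₂.[ a ]) →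
    (∀ a b → ℤ₂ₓ.[ x * γ * (α′ * a + β′ * b) + δ * (x * γ′ * a + δ′ * b) ] ≡ ℤ₂ₓ.[ b ]) →
    (∀ c → ℤy.[ κ * (κ′ * c) ] ≡ ℤy.[ c ]) →
    ∀ g → linear α β γ δ κ (linear α′ β′ γ′ δ′ κ′ g) ≡ g
  linear-inverse α β γ δ κ α′ β′ γ′ δ′ κ′ e₁ e₂ e₃ g@(b , c , e) =
    trans (linear-⟦⟧ α β γ δ κ _ _ _)
          (trans (cong₂ _,_ (e₁ (toℕ b) (toℕ c)) (cong₂ _,_ (e₂ (toℕ b) (toℕ c)) (e₃ (toℕ e)))) (⟦⟧-toℕ g))

  linearAutomorphism : ∀ α β γ δ κ α′ β′ γ′ δ′ κ′ →
    (∀ g → linear α β γ δ κ (linear α′ β′ γ′ δ′ κ′ g) ≡ g) →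
    (∀ g → linear α′ β′ γ′ δ′ κ′ (linear α β γ δ κ g) ≡ g) → Automorphism G
  linearAutomorphism α β γ δ κ α′ β′ γ′ δ′ κ′ inv₁ inv₂ = record
    { perm = mk↔ₛ′ (linear α β γ δ κ) (linear α′ β′ γ′ δ′ κ′) inv₁ inv₂
    ; additive = linear-⊹ α β γ δ κ }

  open Automorphism

  ψ : Automorphism G
  ψ = linearAutomorphism 0 1 1 1 1 1 1 1 (1 + x) 1
        (linear-inverse 0 1 1 1 1 1 1 1 (1 + x) 1
          (λ a b → ℤ₂.[]-≡ 0 (b + jx * b + jx * a) (ψψ⁻¹-ℤ₂ jx a b))
          (λ a b → ℤ₂ₓ.[]-≡ 0 (b + a) (ψψ⁻¹-ℤ₂ₓ jx a b))
          (λ c → ℤy.[]-≡ 0 0 (unit-ℤy jy c)))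
        (linear-inverse 1 1 1 (1 + x) 1 0 1 1 1 1
          (λ a b → ℤ₂.[]-≡ 0 (b + jx * a) (ψ⁻¹ψ-ℤ₂ jx a b))
          (λ a b → ℤ₂ₓ.[]-≡ 0 (b + a + jx * a) (ψ⁻¹ψ-ℤ₂ₓ jx a b))
          (λ c → ℤy.[]-≡ 0 0 (unit-ℤy jy c)))

  F : Automorphism G
  F = linearAutomorphism 1 1 1 2 2 0 1 1 (suc jx + x * jx) (suc jy)
        (linear-inverse 1 1 1 2 2 0 1 1 (suc jx + x * jx) (suc jy)
          (λ a b → ℤ₂.[]-≡ 0 (b + jx * b + jx * a + jx * jx * b) (FF⁻¹-ℤ₂ jx a b))
          (λ a b → ℤ₂ₓ.[]-≡ 0 (b + a + jx * b) (FF⁻¹-ℤ₂ₓ jx a b))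
          (λ c → ℤy.[]-≡ 0 c (FF⁻¹-ℤy jy c)))
        (linear-inverse 0 1 1 (suc jx + x * jx) (suc jy) 1 1 1 2 2
          (λ a b → ℤ₂.[]-≡ 0 (b + jx * a) (F⁻¹F-ℤ₂ jx a b))
          (λ a b → ℤ₂ₓ.[]-≡ 0 (b + a + jx * b + jx * a + jx * jx * a) (F⁻¹F-ℤ₂ₓ jx a b))
          (λ c → ℤy.[]-≡ 0 c (F⁻¹F-ℤy jy c)))

  F≡id⊹ψ : ∀ g → to (perm F) g ≡ g ⊹ to (perm ψ) g
  F≡id⊹ψ g@(b , c , e) = trans (⟦⟧-cong (ℤ₂-part (toℕ b) (toℕ c)) (ℤ₂ₓ-part jx (toℕ b) (toℕ c)) (ℤy-part (toℕ e)))
                           (trans (⟦⟧-+ _ _ _ _ _ _) (cong (_⊹ to (perm ψ) g) (⟦⟧-toℕ g)))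
    where
    ℤ₂-part : ∀ a b → 1 * a + 1 * b ≡ a + (0 * a + 1 * b)
    ℤ₂-part = solve-∀
    ℤ₂ₓ-part : ∀ jx a b → suc (2 * jx) * 1 * a + 2 * b ≡ b + (suc (2 * jx) * 1 * a + 1 * b)
    ℤ₂ₓ-part = solve-∀
    ℤy-part : ∀ e → 2 * e ≡ e + 1 * e
    ℤy-part = solve-∀

  shear : Automorphism G
  shear = linearAutomorphism 1 1 0 1 1 1 1 0 1 1 shear² shear²
    where
    shear² : ∀ g → linear 1 1 0 1 1 (linear 1 1 0 1 1 g) ≡ g
    shear² = linear-inverse 1 1 0 1 1 1 1 0 1 1
               (λ a b → ℤ₂.[]-≡ 0 b (shear²-ℤ₂ jx a b))
               (λ a b → ℤ₂ₓ.[]-≡ 0 0 (shear²-ℤ₂ₓ jx a b))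
               (λ c → ℤy.[]-≡ 0 0 (unit-ℤy jy c))

-- A step is named by its coordinates: x_ab is (a , b , 0) with b read modulo 2x,
-- and y_c is (0 , 0 , c) with c read modulo y.
data XCode : Set where
  x₀₁ x₁₁ x₁₋₁ x₁₋₂ : XCode

data YCode : Set where
  y₁ y₋₁ y₋₂ : YCode

Code : Set
Code = XCode ⊎ YCode

IsX : Code → Set
IsX (inj₁ _) = ⊤
IsX (inj₂ _) = ⊥

IsY : Code → Set
IsY (inj₁ _) = ⊥
IsY (inj₂ _) = ⊤

isX? : ∀ c → Dec (IsX c)
isX? (inj₁ _) = yes tt
isX? (inj₂ _) = no λ ()

isY? : ∀ c → Dec (IsY c)
isY? (inj₁ _) = no λ ()
isY? (inj₂ _) = yes tt

xCode : ∀ c → IsX c → Σ XCode λ c′ → c ≡ inj₁ c′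
xCode (inj₁ c) _ = c , refl

yCode : ∀ c → IsY c → Σ YCode λ c′ → c ≡ inj₂ c′
yCode (inj₂ c) _ = c , refl

-- A template is a family, indexed by a level k, of permutations of a small set of
-- cells, each cell labelled with the code of its step; at level k exactly the
-- first offset + 2k cells take X-steps.
record Template (cells offset levels : ℕ) : Set where
  field
    move move⁻ : Fin (suc levels) → Fin cells → Fin cells
    code       : Fin (suc levels) → Fin cells → Code
    move-move⁻ : ∀ k l → move k (move⁻ k l) ≡ l
    move⁻-move : ∀ k l → move⁻ k (move k l) ≡ l
    code-split : ∀ k l → (toℕ l < offset + 2 * toℕ k → IsX (code k l)) × (offset + 2 * toℕ k ≤ toℕ l → IsY (code k l))

template : ∀ {cells offset levels} (move move⁻ : Fin (suc levels) → Fin cells → Fin cells)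
  (code : Fin (suc levels) → Fin cells → Code) →
  {True (all? λ k → all? λ l → move k (move⁻ k l) F.≟ l)} →
  {True (all? λ k → all? λ l → move⁻ k (move k l) F.≟ l)} →
  {True (all? λ k → all? λ l → (toℕ l ℕ.<? offset + 2 * toℕ k →-dec isX? (code k l)) ×-dec (offset + 2 * toℕ k ℕ.≤? toℕ l →-dec isY? (code k l)))} →
  Template cells offset levels
template move move⁻ code {p₁} {p₂} {p₃} = record
  { move = move ; move⁻ = move⁻ ; code = code
  ; move-move⁻ = toWitness p₁ ; move⁻-move = toWitness p₂ ; code-split = toWitness p₃ }

block2×2 : Template 4 0 2
block2×2 = template move move⁻ code
  where
  move : Fin 3 → Fin 4 → Fin 4
  move 0F 0F = 3F
  move 0F 1F = 2F
  move 0F 2F = 1F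
  move 0F 3F = 0F
  move 1F 0F = 2F
  move 1F 1F = 3F
  move 1F 2F = 1F
  move 1F 3F = 0F
  move 2F 0F = 2F
  move 2F 1F = 3F
  move 2F 2F = 0F
  move 2F 3F = 1F
  move⁻ : Fin 3 → Fin 4 → Fin 4
  move⁻ 0F 0F = 3F
  move⁻ 0F 1F = 2F
  move⁻ 0F 2F = 1F
  move⁻ 0F 3F = 0F
  move⁻ 1F 0F = 3F
  move⁻ 1F 1F = 2F
  move⁻ 1F 2F = 0F
  move⁻ 1F 3F = 1F
  move⁻ 2F 0F = 2F
  move⁻ 2F 1F = 3F
  move⁻ 2F 2F = 0F
  move⁻ 2F 3F = 1F
  code : Fin 3 → Fin 4 → Code
  code 0F 0F = inj₂ y₁
  code 0F 1F = inj₂ y₋₁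
  code 0F 2F = inj₂ y₁
  code 0F 3F = inj₂ y₋₁
  code 1F 0F = inj₁ x₁₁
  code 1F 1F = inj₁ x₁₋₁
  code 1F 2F = inj₂ y₁
  code 1F 3F = inj₂ y₋₁
  code 2F 0F = inj₁ x₁₁
  code 2F 1F = inj₁ x₁₋₁
  code 2F 2F = inj₁ x₁₋₁
  code 2F 3F = inj₁ x₁₁

block2×3 : Template 6 0 3
block2×3 = template move move⁻ code
  where
  move : Fin 4 → Fin 6 → Fin 6
  move 0F 0F = 2F
  move 0F 1F = 4F
  move 0F 2F = 5F
  move 0F 3F = 1F
  move 0F 4F = 3F
  move 0F 5F = 0F
  move 1F 0F = 1F
  move 1F 1F = 0F
  move 1F 2F = 5F
  move 1F 3F = 4F
  move 1F 4F = 3F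
  move 1F 5F = 2F
  move 2F 0F = 1F
  move 2F 1F = 0F
  move 2F 2F = 4F
  move 2F 3F = 5F
  move 2F 4F = 3F
  move 2F 5F = 2F
  move 3F 0F = 1F
  move 3F 1F = 0F
  move 3F 2F = 4F
  move 3F 3F = 5F
  move 3F 4F = 2F
  move 3F 5F = 3F
  move⁻ : Fin 4 → Fin 6 → Fin 6
  move⁻ 0F 0F = 5F
  move⁻ 0F 1F = 3F
  move⁻ 0F 2F = 0F
  move⁻ 0F 3F = 4F
  move⁻ 0F 4F = 1F
  move⁻ 0F 5F = 2F
  move⁻ 1F 0F = 1F
  move⁻ 1F 1F = 0F
  move⁻ 1F 2F = 5F
  move⁻ 1F 3F = 4F
  move⁻ 1F 4F = 3F
  move⁻ 1F 5F = 2F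
  move⁻ 2F 0F = 1F
  move⁻ 2F 1F = 0F
  move⁻ 2F 2F = 5F
  move⁻ 2F 3F = 4F
  move⁻ 2F 4F = 2F
  move⁻ 2F 5F = 3F
  move⁻ 3F 0F = 1F
  move⁻ 3F 1F = 0F
  move⁻ 3F 2F = 4F
  move⁻ 3F 3F = 5F
  move⁻ 3F 4F = 2F
  move⁻ 3F 5F = 3F
  code : Fin 4 → Fin 6 → Code
  code 0F 0F = inj₂ y₁
  code 0F 1F = inj₂ y₁
  code 0F 2F = inj₂ y₁
  code 0F 3F = inj₂ y₋₂
  code 0F 4F = inj₂ y₁
  code 0F 5F = inj₂ y₋₂
  code 1F 0F = inj₁ x₁₁
  code 1F 1F = inj₁ x₁₋₁
  code 1F 2F = inj₂ y₁
  code 1F 3F = inj₂ y₋₁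
  code 1F 4F = inj₂ y₁
  code 1F 5F = inj₂ y₋₁
  code 2F 0F = inj₁ x₁₁
  code 2F 1F = inj₁ x₁₋₁
  code 2F 2F = inj₁ x₁₁
  code 2F 3F = inj₁ x₁₋₁
  code 2F 4F = inj₂ y₁
  code 2F 5F = inj₂ y₋₁
  code 3F 0F = inj₁ x₁₁
  code 3F 1F = inj₁ x₁₋₁
  code 3F 2F = inj₁ x₁₁
  code 3F 3F = inj₁ x₁₋₁
  code 3F 4F = inj₁ x₁₋₁
  code 3F 5F = inj₁ x₁₁

corner9 : Template 9 3 3
corner9 = template move move⁻ code
  where
  move : Fin 4 → Fin 9 → Fin 9
  move 0F 0F = 1F
  move 0F 1F = 2F
  move 0F 2F = 0F
  move 0F 3F = 6F
  move 0F 4F = 5F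
  move 0F 5F = 4F
  move 0F 6F = 3F
  move 0F 7F = 8F
  move 0F 8F = 7F
  move 1F 0F = 1F
  move 1F 1F = 2F
  move 1F 2F = 0F
  move 1F 3F = 5F
  move 1F 4F = 6F
  move 1F 5F = 4F
  move 1F 6F = 3F
  move 1F 7F = 8F
  move 1F 8F = 7F
  move 2F 0F = 1F
  move 2F 1F = 2F
  move 2F 2F = 0F
  move 2F 3F = 5F
  move 2F 4F = 6F
  move 2F 5F = 3F
  move 2F 6F = 4F
  move 2F 7F = 8F
  move 2F 8F = 7F
  move 3F 0F = 1F
  move 3F 1F = 2F
  move 3F 2F = 0F
  move 3F 3F = 5F
  move 3F 4F = 8F
  move 3F 5F = 7F
  move 3F 6F = 4F
  move 3F 7F = 3F
  move 3F 8F = 6F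
  move⁻ : Fin 4 → Fin 9 → Fin 9
  move⁻ 0F 0F = 2F
  move⁻ 0F 1F = 0F
  move⁻ 0F 2F = 1F
  move⁻ 0F 3F = 6F
  move⁻ 0F 4F = 5F
  move⁻ 0F 5F = 4F
  move⁻ 0F 6F = 3F
  move⁻ 0F 7F = 8F
  move⁻ 0F 8F = 7F
  move⁻ 1F 0F = 2F
  move⁻ 1F 1F = 0F
  move⁻ 1F 2F = 1F
  move⁻ 1F 3F = 6F
  move⁻ 1F 4F = 5F
  move⁻ 1F 5F = 3F
  move⁻ 1F 6F = 4F
  move⁻ 1F 7F = 8F
  move⁻ 1F 8F = 7F
  move⁻ 2F 0F = 2F
  move⁻ 2F 1F = 0F
  move⁻ 2F 2F = 1F
  move⁻ 2F 3F = 5F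
  move⁻ 2F 4F = 6F
  move⁻ 2F 5F = 3F
  move⁻ 2F 6F = 4F
  move⁻ 2F 7F = 8F
  move⁻ 2F 8F = 7F
  move⁻ 3F 0F = 2F
  move⁻ 3F 1F = 0F
  move⁻ 3F 2F = 1F
  move⁻ 3F 3F = 7F
  move⁻ 3F 4F = 6F
  move⁻ 3F 5F = 3F
  move⁻ 3F 6F = 8F
  move⁻ 3F 7F = 5F
  move⁻ 3F 8F = 4F
  code : Fin 4 → Fin 9 → Code
  code 0F 0F = inj₁ x₀₁
  code 0F 1F = inj₁ x₁₁
  code 0F 2F = inj₁ x₁₋₂
  code 0F 3F = inj₂ y₁
  code 0F 4F = inj₂ y₋₁
  code 0F 5F = inj₂ y₁
  code 0F 6F = inj₂ y₋₁
  code 0F 7F = inj₂ y₁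
  code 0F 8F = inj₂ y₋₁
  code 1F 0F = inj₁ x₀₁
  code 1F 1F = inj₁ x₁₁
  code 1F 2F = inj₁ x₁₋₂
  code 1F 3F = inj₁ x₁₁
  code 1F 4F = inj₁ x₁₋₁
  code 1F 5F = inj₂ y₁
  code 1F 6F = inj₂ y₋₁
  code 1F 7F = inj₂ y₁
  code 1F 8F = inj₂ y₋₁
  code 2F 0F = inj₁ x₀₁
  code 2F 1F = inj₁ x₁₁
  code 2F 2F = inj₁ x₁₋₂
  code 2F 3F = inj₁ x₁₁
  code 2F 4F = inj₁ x₁₋₁
  code 2F 5F = inj₁ x₁₋₁
  code 2F 6F = inj₁ x₁₁
  code 2F 7F = inj₂ y₁
  code 2F 8F = inj₂ y₋₁
  code 3F 0F = inj₁ x₀₁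
  code 3F 1F = inj₁ x₁₁
  code 3F 2F = inj₁ x₁₋₂
  code 3F 3F = inj₁ x₁₁
  code 3F 4F = inj₁ x₁₋₂
  code 3F 5F = inj₁ x₁₋₂
  code 3F 6F = inj₁ x₁₁
  code 3F 7F = inj₁ x₀₁
  code 3F 8F = inj₁ x₀₁

cornerY3 : Template 3 0 0
cornerY3 = template move move⁻ code
  where
  move : Fin 1 → Fin 3 → Fin 3
  move 0F 0F = 1F
  move 0F 1F = 2F
  move 0F 2F = 0F
  move⁻ : Fin 1 → Fin 3 → Fin 3
  move⁻ 0F 0F = 2F
  move⁻ 0F 1F = 0F
  move⁻ 0F 2F = 1F
  code : Fin 1 → Fin 3 → Code
  code 0F 0F = inj₂ y₁
  code 0F 1F = inj₂ y₁
  code 0F 2F = inj₂ y₋₂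

pair : Template 2 0 1
pair = template move move⁻ code
  where
  move : Fin 2 → Fin 2 → Fin 2
  move 0F 0F = 0F
  move 0F 1F = 1F
  move 1F 0F = 1F
  move 1F 1F = 0F
  move⁻ : Fin 2 → Fin 2 → Fin 2
  move⁻ 0F 0F = 0F
  move⁻ 0F 1F = 1F
  move⁻ 1F 0F = 1F
  move⁻ 1F 1F = 0F
  code : Fin 2 → Fin 2 → Code
  code 0F 0F = inj₂ y₁
  code 0F 1F = inj₂ y₁
  code 1F 0F = inj₁ x₁₁
  code 1F 1F = inj₁ x₁₋₁

cornerX3 : Template 3 3 0
cornerX3 = template move move⁻ code
  where
  move : Fin 1 → Fin 3 → Fin 3
  move 0F 0F = 1F
  move 0F 1F = 2F
  move 0F 2F = 0F
  move⁻ : Fin 1 → Fin 3 → Fin 3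
  move⁻ 0F 0F = 2F
  move⁻ 0F 1F = 0F
  move⁻ 0F 2F = 1F
  code : Fin 1 → Fin 3 → Code
  code 0F 0F = inj₁ x₀₁
  code 0F 1F = inj₁ x₁₁
  code 0F 2F = inj₁ x₁₋₂

fixedY : Template 1 0 0
fixedY = template move move⁻ code
  where
  move : Fin 1 → Fin 1 → Fin 1
  move 0F 0F = 0F
  move⁻ : Fin 1 → Fin 1 → Fin 1
  move⁻ 0F 0F = 0F
  code : Fin 1 → Fin 1 → Code
  code 0F 0F = inj₂ y₁

level : (K : ℕ) → ℕ → Fin (suc K)
level K m = F.fromℕ< (s≤s (m⊓n≤n m K))

level-split : ∀ {cells offset K} (T : Template cells offset K) → cells ≤ offset + 2 * K →
  ∀ m (l : Fin cells) →
  (toℕ l < offset + 2 * m → IsX (Template.code T (level K m) l)) ×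
  (offset + 2 * m ≤ toℕ l → IsY (Template.code T (level K m) l))
level-split {cells} {offset} {K} T cells≤ m l =
    (λ lt → proj₁ (split l) (subst (λ z → toℕ l < offset + 2 * z) (sym toℕ-level) (below lt)))
  , (λ le → proj₂ (split l) (≤-trans (+-monoʳ-≤ offset (*-monoʳ-≤ 2 (subst (_≤ m) (sym toℕ-level) (m⊓n≤m m K)))) le))
  where
  split = Template.code-split T (level K m)
  toℕ-level : toℕ (level K m) ≡ m ℕ.⊓ K
  toℕ-level = toℕ-fromℕ< _
  below : toℕ l < offset + 2 * m → toℕ l < offset + 2 * (m ℕ.⊓ K)
  below lt with m ℕ.≤? K
  ... | yes m≤K = subst (λ z → toℕ l < offset + 2 * z) (sym (m≤n⇒m⊓n≡m m≤K)) lt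
  ... | no  m≰K = subst (λ z → toℕ l < offset + 2 * z) (sym (m≥n⇒m⊓n≡n (≰⇒≥ m≰K))) (≤-trans (toℕ<n l) cells≤)

<-shift : ∀ q h t → 2 * q + t < 2 * h → t < 2 * (h ∸ q)
<-shift q h t lt = subst (t <_) (sym (*-distribˡ-∸ 2 h q)) (cancel (2 * q) t (2 * h) lt)
  where
  cancel : ∀ a t m → a + t < m → t < m ∸ a
  cancel zero    t m       lt       = lt
  cancel (suc a) t (suc m) (s≤s lt) = cancel a t m lt

≥-shift : ∀ q h t → 2 * h ≤ 2 * q + t → 2 * (h ∸ q) ≤ t
≥-shift q h t le = subst (_≤ t) (sym (*-distribˡ-∸ 2 h q)) (m≤n+o⇒m∸n≤o (2 * h) (2 * q) le)

record Finite (A : Set) : Set₁ where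
  field
    _≟ᶠ_ : DecidableEquality A
    ∀?  : ∀ {P : A → Set} → U.Decidable P → Dec (∀ a → P a)

finiteFin : ∀ {k} → Finite (Fin k)
finiteFin = record { _≟ᶠ_ = F._≟_ ; ∀? = all? }

finite× : ∀ {A B} → Finite A → Finite B → Finite (A × B)
finite× FA FB = record
  { _≟ᶠ_ = ×-≡-dec (Finite._≟ᶠ_ FA) (Finite._≟ᶠ_ FB)
  ; ∀?  = λ P? → map′ (λ h (a , b) → h a b) (λ h a b → h (a , b))
                      (Finite.∀? FA λ a → Finite.∀? FB λ b → P? (a , b)) }

finite⊎ : ∀ {A B} → Finite A → Finite B → Finite (A ⊎ B)
finite⊎ FA FB = record
  { _≟ᶠ_ = ⊎-≡-dec (Finite._≟ᶠ_ FA) (Finite._≟ᶠ_ FB)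
  ; ∀?  = λ P? → map′ (λ { (h₁ , h₂) (inj₁ a) → h₁ a ; (h₁ , h₂) (inj₂ b) → h₂ b }) (λ h → h ∘ inj₁ , h ∘ inj₂)
                      (Finite.∀? FA (P? ∘ inj₁) ×-dec Finite.∀? FB (P? ∘ inj₂)) }

finite↔ : ∀ {A B} (FA : Finite A) (FB : Finite B) (f : A → B) (g : B → A) →
  {True (Finite.∀? FB λ b → Finite._≟ᶠ_ FB (f (g b)) b)} →
  {True (Finite.∀? FA λ a → Finite._≟ᶠ_ FA (g (f a)) a)} → A ↔ B
finite↔ FA FB f g {p} {q} = mk↔ₛ′ f g (toWitness p) (toWitness q)

-- Cells (a , row) of the 2 × 3 and 2 × 2 blocks, numbered as in the templates.
layout2×3 : (Fin 2 × Fin 3) ↔ Fin 6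
layout2×3 = finite↔ (finite× finiteFin finiteFin) finiteFin f g
  where
  f : Fin 2 × Fin 3 → Fin 6
  f (0F , 0F) = 0F
  f (1F , 0F) = 1F
  f (0F , 1F) = 2F
  f (1F , 2F) = 3F
  f (1F , 1F) = 4F
  f (0F , 2F) = 5F
  g : Fin 6 → Fin 2 × Fin 3
  g 0F = 0F , 0F
  g 1F = 1F , 0F
  g 2F = 0F , 1F
  g 3F = 1F , 2F
  g 4F = 1F , 1F
  g 5F = 0F , 2F

layout2×2 : (Fin 2 × Fin 2) ↔ Fin 4
layout2×2 = finite↔ (finite× finiteFin finiteFin) finiteFin f g
  where
  f : Fin 2 × Fin 2 → Fin 4
  f (0F , 0F) = 0F
  f (1F , 1F) = 1F
  f (1F , 0F) = 2F
  f (0F , 1F) = 3F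
  g : Fin 4 → Fin 2 × Fin 2
  g 0F = 0F , 0F
  g 1F = 1F , 1F
  g 2F = 1F , 0F
  g 3F = 0F , 1F

-- The first three rows of the first two columns: nine cells for the corner
-- template and three for the Y-cycle.
corner-layout : (Fin 2 × (Fin 2 × Fin 3)) ↔ (Fin 9 ⊎ Fin 3)
corner-layout = finite↔ (finite× finiteFin (finite× finiteFin finiteFin)) (finite⊎ finiteFin finiteFin) f g
  where
  f : Fin 2 × (Fin 2 × Fin 3) → Fin 9 ⊎ Fin 3
  f (0F , 0F , 0F) = inj₁ 0F
  f (1F , 0F , 0F) = inj₁ 1F
  f (1F , 1F , 0F) = inj₁ 2F
  f (1F , 0F , 1F) = inj₁ 3F
  f (1F , 1F , 2F) = inj₁ 4F
  f (1F , 1F , 1F) = inj₁ 5F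
  f (1F , 0F , 2F) = inj₁ 6F
  f (0F , 0F , 1F) = inj₁ 7F
  f (0F , 0F , 2F) = inj₁ 8F
  f (0F , 1F , 0F) = inj₂ 0F
  f (0F , 1F , 1F) = inj₂ 1F
  f (0F , 1F , 2F) = inj₂ 2F
  g : Fin 9 ⊎ Fin 3 → Fin 2 × (Fin 2 × Fin 3)
  g (inj₁ 0F) = 0F , 0F , 0F
  g (inj₁ 1F) = 1F , 0F , 0F
  g (inj₁ 2F) = 1F , 1F , 0F
  g (inj₁ 3F) = 1F , 0F , 1F
  g (inj₁ 4F) = 1F , 1F , 2F
  g (inj₁ 5F) = 1F , 1F , 1F
  g (inj₁ 6F) = 1F , 0F , 2F
  g (inj₁ 7F) = 0F , 0F , 1F
  g (inj₁ 8F) = 0F , 0F , 2F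
  g (inj₂ 0F) = 0F , 1F , 0F
  g (inj₂ 1F) = 0F , 1F , 1F
  g (inj₂ 2F) = 0F , 1F , 2F

thin-corner-layout : (Fin 2 × Fin 2) ↔ (Fin 3 ⊎ Fin 1)
thin-corner-layout = finite↔ (finite× finiteFin finiteFin) (finite⊎ finiteFin finiteFin) f g
  where
  f : Fin 2 × Fin 2 → Fin 3 ⊎ Fin 1
  f (0F , 0F) = inj₁ 0F
  f (1F , 0F) = inj₁ 1F
  f (1F , 1F) = inj₁ 2F
  f (0F , 1F) = inj₂ 0F
  g : Fin 3 ⊎ Fin 1 → Fin 2 × Fin 2
  g (inj₁ 0F) = 0F , 0F
  g (inj₁ 1F) = 1F , 0F
  g (inj₁ 2F) = 1F , 1F
  g (inj₂ 0F) = 0F , 1F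

generator-shear-ℤ₂ₓ : ∀ jx → suc (2 * jx) * 0 * 0 + 1 * 1 ≡ 1
generator-shear-ℤ₂ₓ = solve-∀
generator-F-ℤ₂ₓ : ∀ jx → suc (2 * jx) * 1 * 0 + 2 * 1 ≡ 2
generator-F-ℤ₂ₓ = solve-∀
generator-F-ℤy : ∀ jx → suc (2 * jx) * 1 * 0 + 2 * 0 ≡ 0
generator-F-ℤy = solve-∀
x₁₁+x₁₋₁ : ∀ jx → 1 + (1 + 4 * jx) + 2 * suc (2 * jx) * 0 ≡ 0 + 2 * suc (2 * jx) * 1
x₁₁+x₁₋₁ = solve-∀
y-1 : ∀ jy → 1 + 2 * jy + suc (2 * jy) * 0 ≡ 0 + suc (2 * jy) * 1
y-1 = solve-∀
y-2 : ∀ jy → 2 + 4 * jy + suc (2 * jy) * 0 ≡ 0 + suc (2 * jy) * 2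
y-2 = solve-∀
1+2[1+n]≡3+n*2 : ∀ jn → suc (2 * suc jn) ≡ 3 + jn * 2
1+2[1+n]≡3+n*2 = solve-∀
2*2x*y≡4xy : ∀ jx jy → 2 * (2 * suc (2 * jx)) * suc (2 * jy) ≡ 4 * suc (2 * jx) * suc (2 * jy)
2*2x*y≡4xy = solve-∀
x₁₋₁-wrap : ∀ jx c → suc c + (1 + 4 * jx) + 2 * suc (2 * jx) * 0 ≡ c + 2 * suc (2 * jx) * 1
x₁₋₁-wrap = solve-∀
x₁₋₂-wrap : ∀ jx → 2 + 4 * jx + 2 * suc (2 * jx) * 0 ≡ 0 + 2 * suc (2 * jx) * 1
x₁₋₂-wrap = solve-∀
y₋₁-wrap : ∀ jy r → suc r + 2 * jy + suc (2 * jy) * 0 ≡ r + suc (2 * jy) * 1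
y₋₁-wrap = solve-∀
y₋₂-wrap : ∀ jy r → 2 + r + 4 * jy + suc (2 * jy) * 0 ≡ r + suc (2 * jy) * 2
y₋₂-wrap = solve-∀
2x≡2+4jx : ∀ jx → 2 * suc (2 * jx) ≡ 2 + 4 * jx
2x≡2+4jx = solve-∀

module Steps (jx jy : ℕ) where
  open Group jx jy public
  open Automorphism public

  xStep : XCode → C
  xStep x₀₁  = ⟦ 0 , 1 , 0 ⟧
  xStep x₁₁  = ⟦ 1 , 1 , 0 ⟧
  xStep x₁₋₁ = ⟦ 1 , 1 + 4 * jx , 0 ⟧
  xStep x₁₋₂ = ⟦ 1 , 4 * jx , 0 ⟧

  yStep : YCode → C
  yStep y₁  = ⟦ 0 , 0 , 1 ⟧
  yStep y₋₁ = ⟦ 0 , 0 , 2 * jy ⟧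
  yStep y₋₂ = ⟦ 0 , 0 , 4 * jy ⟧

  step : Code → C
  step (inj₁ c) = xStep c
  step (inj₂ c) = yStep c

  shear-generator : to (perm shear) ⟦ 0 , 1 , 0 ⟧ ≡ ⟦ 1 , 1 , 0 ⟧
  shear-generator = trans (linear-⟦⟧ 1 1 0 1 1 0 1 0) (⟦⟧-cong refl (generator-shear-ℤ₂ₓ jx) refl)

  F-generatorˣ : to (perm F) ⟦ 0 , 1 , 0 ⟧ ≡ ⟦ 1 , 2 , 0 ⟧
  F-generatorˣ = trans (linear-⟦⟧ 1 1 1 2 2 0 1 0) (⟦⟧-cong refl (generator-F-ℤ₂ₓ jx) refl)

  F-generatorʸ : to (perm F) ⟦ 0 , 0 , 1 ⟧ ≡ ⟦ 0 , 0 , 2 ⟧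
  F-generatorʸ = trans (linear-⟦⟧ 1 1 1 2 2 0 0 1) (⟦⟧-cong refl (generator-F-ℤy jx) refl)

  -- Every step is the image of a standard generator under an automorphism of G.
  xAutomorphism : XCode → Automorphism G
  xAutomorphism x₀₁  = id-automorphism
  xAutomorphism x₁₁  = shear
  xAutomorphism x₁₋₁ = ⊟-automorphism ∘ᴬ shear
  xAutomorphism x₁₋₂ = ⊟-automorphism ∘ᴬ F

  xAutomorphism-generator : ∀ c → to (perm (xAutomorphism c)) ⟦ 0 , 1 , 0 ⟧ ≡ xStep c
  xAutomorphism-generator x₀₁  = refl
  xAutomorphism-generator x₁₁  = shear-generator
  xAutomorphism-generator x₁₋₁ = trans (cong ⊟_ shear-generator)
    (⊟-unique _ _ (trans (sym (⟦⟧-+ 1 1 0 1 (1 + 4 * jx) 0)) (⟦⟧-≡ 0 1 0 1 0 0 refl (x₁₁+x₁₋₁ jx) refl)))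
  xAutomorphism-generator x₁₋₂ = trans (cong ⊟_ F-generatorˣ)
    (⊟-unique _ _ (trans (sym (⟦⟧-+ 1 2 0 1 (4 * jx) 0)) (⟦⟧-≡ 0 1 0 1 0 0 refl (x₁₋₂-wrap jx) refl)))

  yAutomorphism : YCode → Automorphism G
  yAutomorphism y₁  = id-automorphism
  yAutomorphism y₋₁ = ⊟-automorphism
  yAutomorphism y₋₂ = ⊟-automorphism ∘ᴬ F

  yAutomorphism-generator : ∀ c → to (perm (yAutomorphism c)) ⟦ 0 , 0 , 1 ⟧ ≡ yStep c
  yAutomorphism-generator y₁  = refl
  yAutomorphism-generator y₋₁ =
    ⊟-unique _ _ (trans (sym (⟦⟧-+ 0 0 1 0 0 (2 * jy))) (⟦⟧-≡ 0 0 0 0 0 1 refl refl (y-1 jy)))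
  yAutomorphism-generator y₋₂ = trans (cong ⊟_ F-generatorʸ)
    (⊟-unique _ _ (trans (sym (⟦⟧-+ 0 0 2 0 0 (4 * jy))) (⟦⟧-≡ 0 0 0 0 0 2 refl refl (y-2 jy))))

  -- G enumerated as the cosets of ⟨(0,1,0)⟩ resp. ⟨(0,0,1)⟩, each run through in order.
  xCosets : (Fin (2 * y) × Fin (2 * x)) ↔ C
  xCosets = mk↔ₛ′ (λ { (a , q) → proj₁ (remQuot {2} y a) , q , proj₂ (remQuot {2} y a) })
                  (λ { (b , q , e) → combine b e , q })
                  (λ { (b , q , e) → cong (λ z → proj₁ z , q , proj₂ z) (remQuot-combine b e) })
                  (λ { (a , q) → cong (_, q) (combine-remQuot {2} y a) })

  yCosets : (Fin (2 * (2 * x)) × Fin y) ↔ C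
  yCosets = mk↔ₛ′ (λ { (a , q) → proj₁ (remQuot {2} (2 * x) a) , proj₂ (remQuot {2} (2 * x) a) , q })
                  (λ { (b , c , q) → combine b c , q })
                  (λ { (b , c , q) → cong (λ z → proj₁ z , proj₂ z , q) (remQuot-combine b c) })
                  (λ { (a , q) → cong (_, q) (combine-remQuot {2} (2 * x) a) })

  xCosets-next : ∀ a q → to xCosets (a , next q) ≡ to xCosets (a , q) ⊹ ⟦ 0 , 1 , 0 ⟧
  xCosets-next a q = cong₂ _,_ (sym (ℤ₂.⊕-identityʳ _)) (cong₂ _,_ (next≡⊕1 q) (sym (ℤy.⊕-identityʳ _)))

  yCosets-next : ∀ a q → to yCosets (a , next q) ≡ to yCosets (a , q) ⊹ ⟦ 0 , 0 , 1 ⟧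
  yCosets-next a q = cong₂ _,_ (sym (ℤ₂.⊕-identityʳ _)) (cong₂ _,_ (sym (ℤ₂ₓ.⊕-identityʳ _)) (next≡⊕1 q))

  automorphism-step : ∀ (α : Automorphism G) e s → to (perm α) e ≡ s →
                      ∀ g → to (perm α) (g ⊹ e) ≡ to (perm α) g ⊹ s
  automorphism-step α e s αe≡s g = trans (additive α g e) (cong (to (perm α) g ⊹_) αe≡s)

  -- Factors are indexed through ι by group elements; the walks of the factor indexed
  -- by u are shifted by the step of u.
  record Design (sp rp : ℕ) : Set where
    field
      ι       : (Fin sp ⊎ Fin rp) ↔ C
      P       : C ↔ C
      code    : C → Code
      P-step  : ∀ g → to P g ≡ g ⊹ step (code g)
      x-steps : ∀ i → IsX (code (to ι (inj₁ i)))
      y-steps : ∀ i → IsY (code (to ι (inj₂ i)))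

  alternating : ℕ → C ↔ C
  alternating zero          = ↔-id _
  alternating (suc zero)    = perm (⊟-automorphism {G})
  alternating (suc (suc k)) = alternating k

  alternating-even : ∀ k u → to (alternating (k * 2)) u ≡ u
  alternating-even zero    u = refl
  alternating-even (suc k) u = alternating-even k u

  alternating-odd : ∀ k u → to (alternating (suc (k * 2))) u ≡ ⊟ u
  alternating-odd zero    u = refl
  alternating-odd (suc k) u = alternating-odd k u

  -- For odd n ≥ 3 the layer differences of factor f, with u = ι f, are
  -- F⁻¹(-u), ψ(F⁻¹(-u)), P u, u, -u, …, u, -u. Each is a bijection in f, and
  -- since F = id + ψ they add up to -u + P u, the step of u.
  module FromDesign {sp rp} (D : Design sp rp) (jn : ℕ) where
    open Design D

    n : ℕ
    n = suc (2 * suc jn)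

    I : Set
    I = Fin sp ⊎ Fin rp

    len order cosets : I → ℕ
    len = twoLengths {sp} {rp} (2 * x * n) (y * n)
    order (inj₁ _) = 2 * x
    order (inj₂ _) = y
    cosets (inj₁ _) = 2 * y
    cosets (inj₂ _) = 2 * (2 * x)

    len≡ : ∀ f → len f ≡ order f * n
    len≡ (inj₁ _) = refl
    len≡ (inj₂ _) = refl

    diff : ℕ → I ↔ C
    diff 0 = ↔-sym (perm F) ↔-∘ (perm (⊟-automorphism {G}) ↔-∘ ι)
    diff 1 = perm ψ ↔-∘ diff 0
    diff 2 = P ↔-∘ ι
    diff (suc (suc (suc k))) = alternating k ↔-∘ ι

    enc : C ↔ Fin (4 * x * y)
    enc = Fin-cast↔ (2*2x*y≡4xy jx jy) ↔-∘ (↔-sym (*↔× {2 * (2 * x)} {y})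
            ↔-∘ ((↔-sym (*↔× {2} {2 * x}) ×-↔ ↔-id _) ↔-∘ ↔-sym (×-assoc _ _ _ _)))

    open LayeredDecomposition G (4 * x * y) n (subst (3 ≤_) (sym (1+2[1+n]≡3+n*2 jn)) (m≤m+n 3 (jn * 2))) enc I len order cosets len≡ diff

    partialSum-3 : ∀ f → partialSum f 3 ≡ step (code (to ι f))
    partialSum-3 f = begin
        ((ε ⊹ d₀) ⊹ to (perm ψ) d₀) ⊹ to P u   ≡⟨ cong (λ z → (z ⊹ to (perm ψ) d₀) ⊹ to P u) (⊹-identityˡ d₀) ⟩
        (d₀ ⊹ to (perm ψ) d₀) ⊹ to P u         ≡⟨ cong (_⊹ to P u) (sym (F≡id⊹ψ d₀)) ⟩
        to (perm F) d₀ ⊹ to P u                ≡⟨ cong (_⊹ to P u) (strictlyInverseˡ (perm F) _) ⟩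
        ⊟ u ⊹ to P u                           ≡⟨ cong (⊟ u ⊹_) (P-step u) ⟩
        ⊟ u ⊹ (u ⊹ step (code u))              ≡⟨ sym (⊹-assoc (⊟ u) u _) ⟩
        (⊟ u ⊹ u) ⊹ step (code u)              ≡⟨ cong (_⊹ step (code u)) (⊹-inverseˡ u) ⟩
        ε ⊹ step (code u)                      ≡⟨ ⊹-identityˡ _ ⟩
        step (code u) ∎
      where
      open ≡-Reasoning
      u = to ι f
      d₀ = to (diff 0) f

    partialSum-3+2k : ∀ f k → partialSum f (3 + k * 2) ≡ partialSum f 3
    partialSum-3+2k f zero    = refl
    partialSum-3+2k f (suc k) = begin
        (partialSum f (3 + k * 2) ⊹ to (alternating (k * 2)) u) ⊹ to (alternating (suc (k * 2))) u
          ≡⟨ cong₂ (λ a b → (partialSum f (3 + k * 2) ⊹ a) ⊹ b) (alternating-even k u) (alternating-odd k u) ⟩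
        (partialSum f (3 + k * 2) ⊹ u) ⊹ ⊟ u  ≡⟨ ⊹-⊟-cancel _ u ⟩
        partialSum f (3 + k * 2)              ≡⟨ partialSum-3+2k f k ⟩
        partialSum f 3 ∎
      where
      open ≡-Reasoning
      u = to ι f

    partialSum-n : ∀ f → partialSum f n ≡ step (code (to ι f))
    partialSum-n f = trans (cong (partialSum f) (1+2[1+n]≡3+n*2 jn)) (trans (partialSum-3+2k f jn) (partialSum-3 f))

    xCodeOf : Fin sp → XCode
    xCodeOf i = proj₁ (xCode _ (x-steps i))

    yCodeOf : Fin rp → YCode
    yCodeOf i = proj₁ (yCode _ (y-steps i))

    orbit : ∀ f → (Fin (cosets f) × Fin (order f)) ↔ C
    orbit (inj₁ i) = perm (xAutomorphism (xCodeOf i)) ↔-∘ xCosets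
    orbit (inj₂ i) = perm (yAutomorphism (yCodeOf i)) ↔-∘ yCosets

    orbit-step : ∀ f a q → to (orbit f) (a , next q) ≡ to (orbit f) (a , q) ⊹ partialSum f n
    orbit-step (inj₁ i) a q =
      trans (cong (to (perm (xAutomorphism (xCodeOf i)))) (xCosets-next a q))
            (trans (automorphism-step (xAutomorphism (xCodeOf i)) _ _ (xAutomorphism-generator (xCodeOf i)) _)
                   (cong (to (orbit (inj₁ i)) (a , q) ⊹_) (sym (trans (partialSum-n (inj₁ i)) (cong step (proj₂ (xCode _ (x-steps i))))))))
    orbit-step (inj₂ i) a q =
      trans (cong (to (perm (yAutomorphism (yCodeOf i)))) (yCosets-next a q))
            (trans (automorphism-step (yAutomorphism (yCodeOf i)) _ _ (yAutomorphism-generator (yCodeOf i)) _)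
                   (cong (to (orbit (inj₂ i)) (a , q) ⊹_) (sym (trans (partialSum-n (inj₂ i)) (cong step (proj₂ (yCode _ (y-steps i))))))))

    decomposition-from-design : HasDecomposition (4 * x * y) n sp rp (2 * x * n) (y * n)
    decomposition-from-design = decomposition orbit orbit-step

  ⟦⟧-step : ∀ {a b c} a′ b′ c′ da db dc k₁ k₂ k₃ k₄ k₅ k₆ →
    a′ + da + 2 * k₁ ≡ a + 2 * k₂ → b′ + db + 2 * x * k₃ ≡ b + 2 * x * k₄ → c′ + dc + y * k₅ ≡ c + y * k₆ →
    ⟦ a , b , c ⟧ ≡ ⟦ a′ , b′ , c′ ⟧ ⊹ ⟦ da , db , dc ⟧
  ⟦⟧-step a′ b′ c′ da db dc k₁ k₂ k₃ k₄ k₅ k₆ e₁ e₂ e₃ =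
    trans (sym (⟦⟧-≡ k₁ k₂ k₃ k₄ k₅ k₆ e₁ e₂ e₃)) (⟦⟧-+ a′ b′ c′ da db dc)

  x₀₁-move : ∀ r → ⟦ 0 , 1 , r ⟧ ≡ ⟦ 0 , 0 , r ⟧ ⊹ step (inj₁ x₀₁)
  x₀₁-move r = ⟦⟧-step 0 0 r 0 1 0 0 0 0 0 0 0 refl refl (cong (_+ y * 0) (+-identityʳ r))

  x₁₁-move : ∀ a c r → ⟦ suc a , suc c , r ⟧ ≡ ⟦ a , c , r ⟧ ⊹ step (inj₁ x₁₁)
  x₁₁-move a c r = ⟦⟧-step a c r 1 1 0 0 0 0 0 0 0
    (cong (_+ 2 * 0) (+-comm a 1)) (cong (_+ 2 * x * 0) (+-comm c 1)) (cong (_+ y * 0) (+-identityʳ r))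

  x₁₋₁-move : ∀ c r → ⟦ 0 , c , r ⟧ ≡ ⟦ 1 , suc c , r ⟧ ⊹ step (inj₁ x₁₋₁)
  x₁₋₁-move c r = ⟦⟧-step 1 (suc c) r 1 (1 + 4 * jx) 0 0 1 0 1 0 0
    refl (x₁₋₁-wrap jx c) (cong (_+ y * 0) (+-identityʳ r))

  x₁₋₂-move : ∀ r → ⟦ 0 , 0 , r ⟧ ≡ ⟦ 1 , 2 , r ⟧ ⊹ step (inj₁ x₁₋₂)
  x₁₋₂-move r = ⟦⟧-step 1 2 r 1 (4 * jx) 0 0 1 0 1 0 0
    refl (x₁₋₂-wrap jx) (cong (_+ y * 0) (+-identityʳ r))

  y₁-move : ∀ a c r → ⟦ a , c , suc r ⟧ ≡ ⟦ a , c , r ⟧ ⊹ step (inj₂ y₁)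
  y₁-move a c r = ⟦⟧-step a c r 0 0 1 0 0 0 0 0 0
    (cong (_+ 2 * 0) (+-identityʳ a)) (cong (_+ 2 * x * 0) (+-identityʳ c)) (cong (_+ y * 0) (+-comm r 1))

  y₋₁-move : ∀ a c r → ⟦ a , c , r ⟧ ≡ ⟦ a , c , suc r ⟧ ⊹ step (inj₂ y₋₁)
  y₋₁-move a c r = ⟦⟧-step a c (suc r) 0 0 (2 * jy) 0 0 0 0 0 1
    (cong (_+ 2 * 0) (+-identityʳ a)) (cong (_+ 2 * x * 0) (+-identityʳ c)) (y₋₁-wrap jy r)

  y₋₂-move : ∀ a c r → ⟦ a , c , r ⟧ ≡ ⟦ a , c , 2 + r ⟧ ⊹ step (inj₂ y₋₂)
  y₋₂-move a c r = ⟦⟧-step a c (2 + r) 0 0 (4 * jy) 0 0 0 0 0 2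
    (cong (_+ 2 * 0) (+-identityʳ a)) (cong (_+ 2 * x * 0) (+-identityʳ c)) (y₋₂-wrap jy r)

  -- G as 2x columns p, column p holding the 2 × y cells ⟦ a , p + a , e ⟧.
  grid↔ : (Fin (2 * x) × (Fin 2 × Fin y)) ↔ C
  grid↔ = mk↔ₛ′ cell uncell cell-uncell uncell-cell
    where
    module Gₓ = AbGroup (ℤ/ (2 * x))
    cell : Fin (2 * x) × (Fin 2 × Fin y) → C
    cell (p , a , e) = ⟦ toℕ a , toℕ p + toℕ a , toℕ e ⟧
    uncell : C → Fin (2 * x) × (Fin 2 × Fin y)
    uncell (b , c , e) = c ℤ₂ₓ.⊕ ℤ₂ₓ.⊖ ℤ₂ₓ.[ toℕ b ] , b , e
    cell-uncell : ∀ g → cell (uncell g) ≡ g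
    cell-uncell (b , c , e) = cong₂ _,_ (ℤ₂.[]-toℕ b) (cong₂ _,_ column (ℤy.[]-toℕ e))
      where
      column : ℤ₂ₓ.[ toℕ (c ℤ₂ₓ.⊕ ℤ₂ₓ.⊖ ℤ₂ₓ.[ toℕ b ]) + toℕ b ] ≡ c
      column = trans (ℤ₂ₓ.[]-+ _ (toℕ b)) (trans (cong₂ ℤ₂ₓ._⊕_ (ℤ₂ₓ.[]-toℕ _) refl) (Gₓ.⊟-⊹-cancel c _))
    uncell-cell : ∀ z → uncell (cell z) ≡ z
    uncell-cell (p , a , e) = cong₂ _,_ column (cong₂ _,_ (ℤ₂.[]-toℕ a) (ℤy.[]-toℕ e))
      where
      column : ℤ₂ₓ.[ toℕ p + toℕ a ] ℤ₂ₓ.⊕ ℤ₂ₓ.⊖ ℤ₂ₓ.[ toℕ ℤ₂.[ toℕ a ] ] ≡ p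
      column = trans (cong (λ z → ℤ₂ₓ.[ toℕ p + toℕ a ] ℤ₂ₓ.⊕ ℤ₂ₓ.⊖ ℤ₂ₓ.[ toℕ z ]) (ℤ₂.[]-toℕ a))
                 (trans (cong (ℤ₂ₓ._⊕ _) (ℤ₂ₓ.[]-+ (toℕ p) (toℕ a)))
                   (trans (Gₓ.⊹-⊟-cancel _ _) (ℤ₂ₓ.[]-toℕ p)))

  record Placement {cells offset levels} (T : Template cells offset levels) : Set where
    field
      loc   : Fin cells → C
      shift : ∀ k l → loc (Template.move T k l) ≡ loc l ⊹ step (Template.code T k l)

    shift-from : ∀ base k l → base ⊹ loc (Template.move T k l) ≡ (base ⊹ loc l) ⊹ step (Template.code T k l)
    shift-from base k l = trans (cong (base ⊹_) (shift k l)) (sym (⊹-assoc base (loc l) _))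

  ordered-design : ∀ {Ord : Set} sp rp → sp + rp ≡ 4 * x * y →
    (order : Fin (4 * x * y) ↔ Ord) (place : Ord ↔ C) (move : Ord ↔ Ord) (code : Ord → Code) →
    (∀ o → to place (to move o) ≡ to place o ⊹ step (code o)) →
    (∀ o → toℕ (from order o) < sp → IsX (code o)) →
    (∀ o → sp ≤ toℕ (from order o) → IsY (code o)) → Design sp rp
  ordered-design sp rp sp+rp≡ order place move code move-step x-before y-after = record
    { ι       = place ↔-∘ (order ↔-∘ split)
    ; P       = place ↔-∘ (move ↔-∘ ↔-sym place)
    ; code    = λ g → code (from place g)
    ; P-step  = λ g → trans (move-step (from place g)) (cong (λ z → z ⊹ step (code (from place g))) (strictlyInverseˡ place g))
    ; x-steps = λ i → subst (IsX ∘ code) (sym (strictlyInverseʳ place _))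
                  (x-before _ (subst (_< sp) (sym (trans (index (inj₁ i)) (toℕ-↑ˡ i rp))) (toℕ<n i)))
    ; y-steps = λ i → subst (IsY ∘ code) (sym (strictlyInverseʳ place _))
                  (y-after _ (subst (sp ≤_) (sym (trans (index (inj₂ i)) (toℕ-↑ʳ sp i))) (m≤m+n sp (toℕ i))))
    }
    where
    split : (Fin sp ⊎ Fin rp) ↔ Fin (4 * x * y)
    split = Fin-cast↔ sp+rp≡ ↔-∘ ↔-sym (+↔⊎ {sp} {rp})
    index : ∀ i → toℕ (from order (to order (to split i))) ≡ toℕ (from (+↔⊎ {sp} {rp}) i)
    index i = trans (cong toℕ (strictlyInverseʳ order _)) (toℕ-Fin-cast↔ sp+rp≡ _)

  block2×3-cells : Placement block2×3
  block2×3-cells = record { loc = loc ; shift = shift }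
    where
      loc : Fin 6 → C
      loc l = ⟦ toℕ (proj₁ (from layout2×3 l)) , toℕ (proj₁ (from layout2×3 l)) , toℕ (proj₂ (from layout2×3 l)) ⟧
      shift : ∀ k l → loc (Template.move block2×3 k l) ≡ loc l ⊹ step (Template.code block2×3 k l)
      shift 0F 0F = y₁-move 0 0 0
      shift 0F 1F = y₁-move 1 1 0
      shift 0F 2F = y₁-move 0 0 1
      shift 0F 3F = y₋₂-move 1 1 0
      shift 0F 4F = y₁-move 1 1 1
      shift 0F 5F = y₋₂-move 0 0 0
      shift 1F 0F = x₁₁-move 0 0 0
      shift 1F 1F = x₁₋₁-move 0 0
      shift 1F 2F = y₁-move 0 0 1
      shift 1F 3F = y₋₁-move 1 1 1
      shift 1F 4F = y₁-move 1 1 1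
      shift 1F 5F = y₋₁-move 0 0 1
      shift 2F 0F = x₁₁-move 0 0 0
      shift 2F 1F = x₁₋₁-move 0 0
      shift 2F 2F = x₁₁-move 0 0 1
      shift 2F 3F = x₁₋₁-move 0 2
      shift 2F 4F = y₁-move 1 1 1
      shift 2F 5F = y₋₁-move 0 0 1
      shift 3F 0F = x₁₁-move 0 0 0
      shift 3F 1F = x₁₋₁-move 0 0
      shift 3F 2F = x₁₁-move 0 0 1
      shift 3F 3F = x₁₋₁-move 0 2
      shift 3F 4F = x₁₋₁-move 0 1
      shift 3F 5F = x₁₁-move 0 0 2

  block2×2-cells : Placement block2×2
  block2×2-cells = record { loc = loc ; shift = shift }
    where
      loc : Fin 4 → C
      loc l = ⟦ toℕ (proj₁ (from layout2×2 l)) , toℕ (proj₁ (from layout2×2 l)) , toℕ (proj₂ (from layout2×2 l)) ⟧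
      shift : ∀ k l → loc (Template.move block2×2 k l) ≡ loc l ⊹ step (Template.code block2×2 k l)
      shift 0F 0F = y₁-move 0 0 0
      shift 0F 1F = y₋₁-move 1 1 0
      shift 0F 2F = y₁-move 1 1 0
      shift 0F 3F = y₋₁-move 0 0 0
      shift 1F 0F = x₁₁-move 0 0 0
      shift 1F 1F = x₁₋₁-move 0 1
      shift 1F 2F = y₁-move 1 1 0
      shift 1F 3F = y₋₁-move 0 0 0
      shift 2F 0F = x₁₁-move 0 0 0
      shift 2F 1F = x₁₋₁-move 0 1
      shift 2F 2F = x₁₋₁-move 0 0
      shift 2F 3F = x₁₁-move 0 0 1

  corner-cell : Fin 9 ⊎ Fin 3 → C
  corner-cell z = ⟦ toℕ a , toℕ dp + toℕ a , toℕ r ⟧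
    where
    dp = proj₁ (from corner-layout z)
    a  = proj₁ (proj₂ (from corner-layout z))
    r  = proj₂ (proj₂ (from corner-layout z))

  corner9-cells : Placement corner9
  corner9-cells = record { loc = loc ; shift = shift }
    where
      loc : Fin 9 → C
      loc l = corner-cell (inj₁ l)
      shift : ∀ k l → loc (Template.move corner9 k l) ≡ loc l ⊹ step (Template.code corner9 k l)
      shift 0F 0F = x₀₁-move 0
      shift 0F 1F = x₁₁-move 0 1 0
      shift 0F 2F = x₁₋₂-move 0
      shift 0F 3F = y₁-move 0 1 1
      shift 0F 4F = y₋₁-move 1 2 1
      shift 0F 5F = y₁-move 1 2 1
      shift 0F 6F = y₋₁-move 0 1 1
      shift 0F 7F = y₁-move 0 0 1
      shift 0F 8F = y₋₁-move 0 0 1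
      shift 1F 0F = x₀₁-move 0
      shift 1F 1F = x₁₁-move 0 1 0
      shift 1F 2F = x₁₋₂-move 0
      shift 1F 3F = x₁₁-move 0 1 1
      shift 1F 4F = x₁₋₁-move 1 2
      shift 1F 5F = y₁-move 1 2 1
      shift 1F 6F = y₋₁-move 0 1 1
      shift 1F 7F = y₁-move 0 0 1
      shift 1F 8F = y₋₁-move 0 0 1
      shift 2F 0F = x₀₁-move 0
      shift 2F 1F = x₁₁-move 0 1 0
      shift 2F 2F = x₁₋₂-move 0
      shift 2F 3F = x₁₁-move 0 1 1
      shift 2F 4F = x₁₋₁-move 1 2
      shift 2F 5F = x₁₋₁-move 1 1
      shift 2F 6F = x₁₁-move 0 1 2
      shift 2F 7F = y₁-move 0 0 1
      shift 2F 8F = y₋₁-move 0 0 1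
      shift 3F 0F = x₀₁-move 0
      shift 3F 1F = x₁₁-move 0 1 0
      shift 3F 2F = x₁₋₂-move 0
      shift 3F 3F = x₁₁-move 0 1 1
      shift 3F 4F = x₁₋₂-move 2
      shift 3F 5F = x₁₋₂-move 1
      shift 3F 6F = x₁₁-move 0 1 2
      shift 3F 7F = x₀₁-move 1
      shift 3F 8F = x₀₁-move 2

  cornerY3-cells : Placement cornerY3
  cornerY3-cells = record { loc = loc ; shift = shift }
    where
      loc : Fin 3 → C
      loc l = corner-cell (inj₂ l)
      shift : ∀ k l → loc (Template.move cornerY3 k l) ≡ loc l ⊹ step (Template.code cornerY3 k l)
      shift 0F 0F = y₁-move 1 1 0
      shift 0F 1F = y₁-move 1 1 1
      shift 0F 2F = y₋₂-move 1 1 0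

  columns↔ : Fin (2 * x) ↔ (Fin 2 ⊎ Fin (4 * jx))
  columns↔ = +↔⊎ {2} {4 * jx} ↔-∘ Fin-cast↔ (2x≡2+4jx jx)

  toℕ-columns↔⁻-first : ∀ dp → toℕ (from columns↔ (inj₁ dp)) ≡ toℕ dp
  toℕ-columns↔⁻-first dp = trans (toℕ-Fin-cast↔⁻ (2x≡2+4jx jx) _) (toℕ-↑ˡ dp (4 * jx))

wide-even-size : ∀ jx S → 4 * suc (2 * jx) * suc (2 * suc S) ≡ 2 * suc (2 * jx) * (6 + S * 4)
wide-even-size = solve-∀
wide-odd-size : ∀ jx S → 4 * suc (2 * jx) * suc (2 * suc S) ≡ (9 + S * 8) + (4 * jx * (6 + S * 4) + 3)
wide-odd-size = solve-∀

-- y = 3 + 2S: each column is a unit consisting of a 2 × 3 block and S blocks 2 × 2.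
module WideUnits (jx S : ℕ) where
  open Steps jx (suc S) public

  rows↔ : Fin y ↔ (Fin 3 ⊎ (Fin S × Fin 2))
  rows↔ = (↔-id _ ⊎-↔ *↔× {S} {2}) ↔-∘ (+↔⊎ {3} {S * 2} ↔-∘ Fin-cast↔ (1+2[1+n]≡3+n*2 S))

  toℕ-rows↔⁻-top : ∀ r → toℕ (from rows↔ (inj₁ r)) ≡ toℕ r
  toℕ-rows↔⁻-top r = trans (toℕ-Fin-cast↔⁻ (1+2[1+n]≡3+n*2 S) _) (toℕ-↑ˡ r (S * 2))

  toℕ-rows↔⁻-pairs : ∀ s r → toℕ (from rows↔ (inj₂ (s , r))) ≡ 3 + (2 * toℕ s + toℕ r)
  toℕ-rows↔⁻-pairs s r = trans (toℕ-Fin-cast↔⁻ (1+2[1+n]≡3+n*2 S) _) (trans (toℕ-↑ʳ 3 (combine s r)) (cong (3 +_) (toℕ-combine s r)))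

  Unit : Set
  Unit = Fin 6 ⊎ (Fin S × Fin 4)

  unit↔ : (Fin 2 × Fin y) ↔ Unit
  unit↔ = (layout2×3 ⊎-↔ ((↔-id _ ×-↔ layout2×2) ↔-∘ swap-pair)) ↔-∘ (×-distribˡ-⊎ _ _ _ _ ↔-∘ (↔-id _ ×-↔ rows↔))
    where
    swap-pair : (Fin 2 × (Fin S × Fin 2)) ↔ (Fin S × (Fin 2 × Fin 2))
    swap-pair = mk↔ₛ′ (λ { (a , s , r) → s , a , r }) (λ { (s , a , r) → a , s , r }) (λ _ → refl) (λ _ → refl)

  unit-cell : Fin (2 * x) → Unit → C
  unit-cell p u = to grid↔ (p , from unit↔ u)

  unit-cell-2×3 : ∀ p l → unit-cell p (inj₁ l) ≡ ⟦ 0 , toℕ p , 0 ⟧ ⊹ Placement.loc block2×3-cells l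
  unit-cell-2×3 p l = trans (⟦⟧-cong refl refl (toℕ-rows↔⁻-top _)) (⟦⟧-+ 0 (toℕ p) 0 _ _ _)

  unit-cell-2×2 : ∀ p s l → unit-cell p (inj₂ (s , l)) ≡ ⟦ 0 , toℕ p , 3 + 2 * toℕ s ⟧ ⊹ Placement.loc block2×2-cells l
  unit-cell-2×2 p s l = trans (⟦⟧-cong refl refl (toℕ-rows↔⁻-pairs s _)) (⟦⟧-+ 0 (toℕ p) (3 + 2 * toℕ s) _ _ _)

  block2×2-offset : ℕ → Fin S → ℕ
  block2×2-offset q s = q + (3 + 2 * toℕ s)

  -- In a unit preceded by 2q cells of the ordering, each block gets the level that
  -- makes its X-steps continue the first 2h X-steps of the ordering.
  unit-move unit-move⁻ : ℕ → ℕ → Unit → Unit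
  unit-move h q (inj₁ l) = inj₁ (Template.move block2×3 (level 3 (h ∸ q)) l)
  unit-move h q (inj₂ (s , l)) = inj₂ (s , Template.move block2×2 (level 2 (h ∸ block2×2-offset q s)) l)
  unit-move⁻ h q (inj₁ l) = inj₁ (Template.move⁻ block2×3 (level 3 (h ∸ q)) l)
  unit-move⁻ h q (inj₂ (s , l)) = inj₂ (s , Template.move⁻ block2×2 (level 2 (h ∸ block2×2-offset q s)) l)

  unit-move-move⁻ : ∀ h q u → unit-move h q (unit-move⁻ h q u) ≡ u
  unit-move-move⁻ h q (inj₁ l) = cong inj₁ (Template.move-move⁻ block2×3 _ l)
  unit-move-move⁻ h q (inj₂ (s , l)) = cong (λ z → inj₂ (s , z)) (Template.move-move⁻ block2×2 _ l)

  unit-move⁻-move : ∀ h q u → unit-move⁻ h q (unit-move h q u) ≡ u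
  unit-move⁻-move h q (inj₁ l) = cong inj₁ (Template.move⁻-move block2×3 _ l)
  unit-move⁻-move h q (inj₂ (s , l)) = cong (λ z → inj₂ (s , z)) (Template.move⁻-move block2×2 _ l)

  unit-code : ℕ → ℕ → Unit → Code
  unit-code h q (inj₁ l) = Template.code block2×3 (level 3 (h ∸ q)) l
  unit-code h q (inj₂ (s , l)) = Template.code block2×2 (level 2 (h ∸ block2×2-offset q s)) l

  unit-step : ∀ h q p u → unit-cell p (unit-move h q u) ≡ unit-cell p u ⊹ step (unit-code h q u)
  unit-step h q p (inj₁ l) =
    trans (unit-cell-2×3 p (Template.move block2×3 k l))
          (trans (Placement.shift-from block2×3-cells ⟦ 0 , toℕ p , 0 ⟧ k l) (cong (_⊹ step (Template.code block2×3 k l)) (sym (unit-cell-2×3 p l))))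
    where k = level 3 (h ∸ q)
  unit-step h q p (inj₂ (s , l)) =
    trans (unit-cell-2×2 p s (Template.move block2×2 k l))
          (trans (Placement.shift-from block2×2-cells ⟦ 0 , toℕ p , 3 + 2 * toℕ s ⟧ k l) (cong (_⊹ step (Template.code block2×2 k l)) (sym (unit-cell-2×2 p s l))))
    where k = level 2 (h ∸ block2×2-offset q s)

  unit-index : Unit → ℕ
  unit-index (inj₁ l) = toℕ l
  unit-index (inj₂ (s , l)) = 6 + (4 * toℕ s + toℕ l)

  unit-index-2×2 : ∀ q s (l : Fin 4) → 2 * q + (6 + (4 * toℕ s + toℕ l)) ≡ 2 * block2×2-offset q s + toℕ l
  unit-index-2×2 q s l = shape q (toℕ s) (toℕ l)
    where
    shape : ∀ q s l → 2 * q + (6 + (4 * s + l)) ≡ 2 * (q + (3 + 2 * s)) + l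
    shape = solve-∀

  unit-x : ∀ h q u → 2 * q + unit-index u < 2 * h → IsX (unit-code h q u)
  unit-x h q (inj₁ l) lt = proj₁ (level-split block2×3 ≤-refl (h ∸ q) l) (<-shift q h (toℕ l) lt)
  unit-x h q (inj₂ (s , l)) lt = proj₁ (level-split block2×2 ≤-refl _ l)
    (<-shift (block2×2-offset q s) h (toℕ l) (subst (_< 2 * h) (unit-index-2×2 q s l) lt))

  unit-y : ∀ h q u → 2 * h ≤ 2 * q + unit-index u → IsY (unit-code h q u)
  unit-y h q (inj₁ l) le = proj₂ (level-split block2×3 ≤-refl (h ∸ q) l) (≥-shift q h (toℕ l) le)
  unit-y h q (inj₂ (s , l)) le = proj₂ (level-split block2×2 ≤-refl _ l)
    (≥-shift (block2×2-offset q s) h (toℕ l) (subst (2 * h ≤_) (unit-index-2×2 q s l) le))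

  unit-size : ℕ
  unit-size = 6 + S * 4

  unit-order : Fin unit-size ↔ Unit
  unit-order = (↔-id _ ⊎-↔ *↔× {S} {4}) ↔-∘ +↔⊎ {6} {S * 4}

  toℕ-unit-order⁻ : ∀ u → toℕ (from unit-order u) ≡ unit-index u
  toℕ-unit-order⁻ (inj₁ l) = toℕ-↑ˡ l (S * 4)
  toℕ-unit-order⁻ (inj₂ (s , l)) = trans (toℕ-↑ʳ 6 (combine s l)) (cong (6 +_) (toℕ-combine s l))

  column-offset : ℕ → ℕ
  column-offset p = (3 + S * 2) * p

  unit-size*p : ∀ p → unit-size * p ≡ 2 * column-offset p
  unit-size*p p = shape S p
    where
    shape : ∀ S p → (6 + S * 4) * p ≡ 2 * ((3 + S * 2) * p)
    shape = solve-∀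

  units-move : ∀ {P : Set} (h : ℕ) (q : P → ℕ) → (P × Unit) ↔ (P × Unit)
  units-move h q = mk↔ₛ′ (λ { (p , u) → p , unit-move h (q p) u }) (λ { (p , u) → p , unit-move⁻ h (q p) u })
                         (λ { (p , u) → cong (p ,_) (unit-move-move⁻ h (q p) u) })
                         (λ { (p , u) → cong (p ,_) (unit-move⁻-move h (q p) u) })

  wide-even-design : ∀ h rp → 2 * h + rp ≡ 4 * x * y → Design (2 * h) rp
  wide-even-design h rp sizes =
    ordered-design (2 * h) rp sizes order place (units-move h q) code
      (λ { (p , u) → unit-step h (q p) p u })
      (λ { (p , u) lt → unit-x h (q p) u (subst (_< 2 * h) (index p u) lt) })
      (λ { (p , u) le → unit-y h (q p) u (subst (2 * h ≤_) (index p u) le) })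
    where
    q : Fin (2 * x) → ℕ
    q p = column-offset (toℕ p)
    order : Fin (4 * x * y) ↔ (Fin (2 * x) × Unit)
    order = (↔-id _ ×-↔ unit-order) ↔-∘ (*↔× {2 * x} {unit-size} ↔-∘ Fin-cast↔ (wide-even-size jx S))
    place : (Fin (2 * x) × Unit) ↔ C
    place = grid↔ ↔-∘ ↔-sym (↔-id _ ×-↔ unit↔)
    code : Fin (2 * x) × Unit → Code
    code (p , u) = unit-code h (q p) u
    index : ∀ p u → toℕ (from order (p , u)) ≡ 2 * q p + unit-index u
    index p u = trans (toℕ-Fin-cast↔⁻ (wide-even-size jx S) _)
                  (trans (toℕ-combine p (from unit-order u)) (cong₂ _+_ (unit-size*p (toℕ p)) (toℕ-unit-order⁻ u)))

  -- sp = 3 + 2h: the three extra X-steps come from a 3-cycle through the first two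
  -- columns (the corner template); three cells there take a Y-cycle instead.
  Blocks : Set
  Blocks = Fin S × (Fin 2 × Fin 4)

  Odd : Set
  Odd = (Fin 9 ⊎ Blocks) ⊎ ((Fin (4 * jx) × Unit) ⊎ Fin 3)

  corner↔ : (Fin 2 × (Fin 2 × Fin y)) ↔ ((Fin 9 ⊎ Fin 3) ⊎ Blocks)
  corner↔ = (corner-layout ⊎-↔ to-blocks) ↔-∘ (×-distribˡ-⊎ _ _ _ _ ↔-∘ (↔-id _ ×-↔ (×-distribˡ-⊎ _ _ _ _ ↔-∘ (↔-id _ ×-↔ rows↔))))
    where
    to-blocks : (Fin 2 × (Fin 2 × (Fin S × Fin 2))) ↔ Blocks
    to-blocks = mk↔ₛ′ (λ { (dp , a , s , r) → s , dp , to layout2×2 (a , r) })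
                      (λ { (s , dp , l) → dp , proj₁ (from layout2×2 l) , s , proj₂ (from layout2×2 l) })
                      (λ { (s , dp , l) → cong (λ z → s , dp , z) (strictlyInverseˡ layout2×2 l) })
                      (λ { (dp , a , s , r) → cong (λ z → dp , proj₁ z , s , proj₂ z) (strictlyInverseʳ layout2×2 (a , r)) })

  odd-grid↔ : (Fin (2 * x) × (Fin 2 × Fin y)) ↔ Odd
  odd-grid↔ = reorder ↔-∘ ((corner↔ ⊎-↔ (↔-id _ ×-↔ unit↔)) ↔-∘ (×-distribʳ-⊎ _ _ _ _ ↔-∘ (columns↔ ×-↔ ↔-id _)))
    where
    reorder : ∀ {A B C D : Set} → (((A ⊎ B) ⊎ C) ⊎ D) ↔ ((A ⊎ C) ⊎ (D ⊎ B))
    reorder = mk↔ₛ′ f g f∘g g∘f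
      where
      f : _
      f (inj₁ (inj₁ (inj₁ a))) = inj₁ (inj₁ a)
      f (inj₁ (inj₁ (inj₂ b))) = inj₂ (inj₂ b)
      f (inj₁ (inj₂ c))        = inj₁ (inj₂ c)
      f (inj₂ d)               = inj₂ (inj₁ d)
      g : _
      g (inj₁ (inj₁ a)) = inj₁ (inj₁ (inj₁ a))
      g (inj₂ (inj₂ b)) = inj₁ (inj₁ (inj₂ b))
      g (inj₁ (inj₂ c)) = inj₁ (inj₂ c)
      g (inj₂ (inj₁ d)) = inj₂ d
      f∘g : ∀ z → f (g z) ≡ z
      f∘g (inj₁ (inj₁ a)) = refl
      f∘g (inj₂ (inj₂ b)) = refl
      f∘g (inj₁ (inj₂ c)) = refl
      f∘g (inj₂ (inj₁ d)) = refl
      g∘f : ∀ z → g (f z) ≡ z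
      g∘f (inj₁ (inj₁ (inj₁ a))) = refl
      g∘f (inj₁ (inj₁ (inj₂ b))) = refl
      g∘f (inj₁ (inj₂ c))        = refl
      g∘f (inj₂ d)               = refl

  odd-place : Odd ↔ C
  odd-place = grid↔ ↔-∘ ↔-sym odd-grid↔

  odd-place-corner9 : ∀ l → to odd-place (inj₁ (inj₁ l)) ≡ Placement.loc corner9-cells l
  odd-place-corner9 l = ⟦⟧-cong refl (cong (_+ _) (toℕ-columns↔⁻-first _)) (toℕ-rows↔⁻-top _)

  odd-place-cornerY3 : ∀ l → to odd-place (inj₂ (inj₂ l)) ≡ Placement.loc cornerY3-cells l
  odd-place-cornerY3 l = ⟦⟧-cong refl (cong (_+ _) (toℕ-columns↔⁻-first _)) (toℕ-rows↔⁻-top _)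

  odd-place-block : ∀ s dp l → to odd-place (inj₁ (inj₂ (s , dp , l))) ≡ ⟦ 0 , toℕ dp , 3 + 2 * toℕ s ⟧ ⊹ Placement.loc block2×2-cells l
  odd-place-block s dp l = trans (⟦⟧-cong refl (cong (_+ _) (toℕ-columns↔⁻-first dp)) (toℕ-rows↔⁻-pairs s _))
                                 (⟦⟧-+ 0 (toℕ dp) (3 + 2 * toℕ s) _ _ _)

  odd-order : Fin (4 * x * y) ↔ Odd
  odd-order = (((↔-id _ ⊎-↔ ((↔-id _ ×-↔ *↔× {2} {4}) ↔-∘ *↔× {S} {8})) ↔-∘ +↔⊎ {9} {S * 8})
              ⊎-↔ ((((↔-id _ ×-↔ unit-order) ↔-∘ *↔× {4 * jx} {unit-size}) ⊎-↔ ↔-id _) ↔-∘ +↔⊎ {4 * jx * unit-size} {3}))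
              ↔-∘ (+↔⊎ {9 + S * 8} {4 * jx * unit-size + 3} ↔-∘ Fin-cast↔ (wide-odd-size jx S))

  corner-size : ℕ
  corner-size = 9 + S * 8

  odd-index-corner9 : ∀ l → toℕ (from odd-order (inj₁ (inj₁ l))) ≡ toℕ l
  odd-index-corner9 l = trans (toℕ-Fin-cast↔⁻ (wide-odd-size jx S) _) (trans (toℕ-↑ˡ _ (4 * jx * unit-size + 3)) (toℕ-↑ˡ l (S * 8)))

  odd-index-block : ∀ s dp l → toℕ (from odd-order (inj₁ (inj₂ (s , dp , l)))) ≡ 9 + (8 * toℕ s + (4 * toℕ dp + toℕ l))
  odd-index-block s dp l = trans (toℕ-Fin-cast↔⁻ (wide-odd-size jx S) _) (trans (toℕ-↑ˡ _ (4 * jx * unit-size + 3)) (trans (toℕ-↑ʳ 9 _)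
    (cong (9 +_) (trans (toℕ-combine s (combine dp l)) (cong (8 * toℕ s +_) (toℕ-combine dp l))))))

  odd-index-unit : ∀ p u → toℕ (from odd-order (inj₂ (inj₁ (p , u)))) ≡ corner-size + (unit-size * toℕ p + unit-index u)
  odd-index-unit p u = trans (toℕ-Fin-cast↔⁻ (wide-odd-size jx S) _) (trans (toℕ-↑ʳ corner-size _) (cong (corner-size +_)
    (trans (toℕ-↑ˡ _ 3) (trans (toℕ-combine p _) (cong (unit-size * toℕ p +_) (toℕ-unit-order⁻ u))))))

  odd-index-cornerY3 : ∀ l → toℕ (from odd-order (inj₂ (inj₂ l))) ≡ corner-size + (4 * jx * unit-size + toℕ l)
  odd-index-cornerY3 l = trans (toℕ-Fin-cast↔⁻ (wide-odd-size jx S) _) (trans (toℕ-↑ʳ corner-size _) (cong (corner-size +_) (toℕ-↑ʳ (4 * jx * unit-size) l)))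

  module WideOdd (h : ℕ) where
    block-offset : Fin S → Fin 2 → ℕ
    block-offset s dp = 3 + (4 * toℕ s + 2 * toℕ dp)
    unit-offset : Fin (4 * jx) → ℕ
    unit-offset p = 3 + (S * 4 + column-offset (toℕ p))

    block-level : Fin S → Fin 2 → Fin 3
    block-level s dp = level 2 (h ∸ block-offset s dp)

    move move⁻ : Odd → Odd
    move (inj₁ (inj₁ l))            = inj₁ (inj₁ (Template.move corner9 (level 3 h) l))
    move (inj₁ (inj₂ (s , dp , l))) = inj₁ (inj₂ (s , dp , Template.move block2×2 (block-level s dp) l))
    move (inj₂ (inj₁ (p , u)))      = inj₂ (inj₁ (p , unit-move h (unit-offset p) u))
    move (inj₂ (inj₂ l))            = inj₂ (inj₂ (Template.move cornerY3 0F l))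
    move⁻ (inj₁ (inj₁ l))            = inj₁ (inj₁ (Template.move⁻ corner9 (level 3 h) l))
    move⁻ (inj₁ (inj₂ (s , dp , l))) = inj₁ (inj₂ (s , dp , Template.move⁻ block2×2 (block-level s dp) l))
    move⁻ (inj₂ (inj₁ (p , u)))      = inj₂ (inj₁ (p , unit-move⁻ h (unit-offset p) u))
    move⁻ (inj₂ (inj₂ l))            = inj₂ (inj₂ (Template.move⁻ cornerY3 0F l))

    move-move⁻ : ∀ o → move (move⁻ o) ≡ o
    move-move⁻ (inj₁ (inj₁ l))            = cong (inj₁ ∘ inj₁) (Template.move-move⁻ corner9 _ l)
    move-move⁻ (inj₁ (inj₂ (s , dp , l))) = cong (λ z → inj₁ (inj₂ (s , dp , z))) (Template.move-move⁻ block2×2 _ l)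
    move-move⁻ (inj₂ (inj₁ (p , u)))      = cong (λ z → inj₂ (inj₁ (p , z))) (unit-move-move⁻ h (unit-offset p) u)
    move-move⁻ (inj₂ (inj₂ l))            = cong (inj₂ ∘ inj₂) (Template.move-move⁻ cornerY3 0F l)

    move⁻-move : ∀ o → move⁻ (move o) ≡ o
    move⁻-move (inj₁ (inj₁ l))            = cong (inj₁ ∘ inj₁) (Template.move⁻-move corner9 _ l)
    move⁻-move (inj₁ (inj₂ (s , dp , l))) = cong (λ z → inj₁ (inj₂ (s , dp , z))) (Template.move⁻-move block2×2 _ l)
    move⁻-move (inj₂ (inj₁ (p , u)))      = cong (λ z → inj₂ (inj₁ (p , z))) (unit-move⁻-move h (unit-offset p) u)
    move⁻-move (inj₂ (inj₂ l))            = cong (inj₂ ∘ inj₂) (Template.move⁻-move cornerY3 0F l)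

    code : Odd → Code
    code (inj₁ (inj₁ l))            = Template.code corner9 (level 3 h) l
    code (inj₁ (inj₂ (s , dp , l))) = Template.code block2×2 (block-level s dp) l
    code (inj₂ (inj₁ (p , u)))      = unit-code h (unit-offset p) u
    code (inj₂ (inj₂ l))            = Template.code cornerY3 0F l

    move-step : ∀ o → to odd-place (move o) ≡ to odd-place o ⊹ step (code o)
    move-step (inj₁ (inj₁ l)) =
      trans (odd-place-corner9 (Template.move corner9 (level 3 h) l)) (trans (Placement.shift corner9-cells (level 3 h) l) (cong (_⊹ step (code (inj₁ (inj₁ l)))) (sym (odd-place-corner9 l))))
    move-step (inj₁ (inj₂ (s , dp , l))) =
      trans (odd-place-block s dp (Template.move block2×2 (block-level s dp) l))
            (trans (Placement.shift-from block2×2-cells ⟦ 0 , toℕ dp , 3 + 2 * toℕ s ⟧ (block-level s dp) l)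
                   (cong (_⊹ step (code (inj₁ (inj₂ (s , dp , l))))) (sym (odd-place-block s dp l))))
    move-step (inj₂ (inj₁ (p , u))) = unit-step h (unit-offset p) (from columns↔ (inj₂ p)) u
    move-step (inj₂ (inj₂ l)) =
      trans (odd-place-cornerY3 (Template.move cornerY3 0F l)) (trans (Placement.shift cornerY3-cells 0F l) (cong (_⊹ step (code (inj₂ (inj₂ l)))) (sym (odd-place-cornerY3 l))))

    block-index-shape : ∀ s dp l → 9 + (8 * s + (4 * dp + l)) ≡ 3 + (2 * (3 + (4 * s + 2 * dp)) + l)
    block-index-shape = solve-∀
    unit-index-shape : ∀ s p t → (9 + s * 8) + ((6 + s * 4) * p + t) ≡ 3 + (2 * (3 + (s * 4 + (3 + s * 2) * p)) + t)
    unit-index-shape = solve-∀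

    corner-before : ∀ rp → (3 + 2 * h) + rp ≡ 4 * x * y → 3 ≤ rp → 3 + 2 * h ≤ corner-size + 4 * jx * unit-size
    corner-before rp sizes 3≤rp = +-cancelʳ-≤ 3 (3 + 2 * h) _
      (subst (3 + 2 * h + 3 ≤_) (trans (trans sizes (wide-odd-size jx S)) (sym (+-assoc corner-size _ 3))) (+-monoʳ-≤ (3 + 2 * h) 3≤rp))

    x-before : 3 + 2 * h ≤ corner-size + 4 * jx * unit-size → ∀ o → toℕ (from odd-order o) < 3 + 2 * h → IsX (code o)
    x-before _ (inj₁ (inj₁ l)) lt = proj₁ (level-split corner9 ≤-refl h l) (subst (_< 3 + 2 * h) (odd-index-corner9 l) lt)
    x-before _ (inj₁ (inj₂ (s , dp , l))) lt = proj₁ (level-split block2×2 ≤-refl _ l) (<-shift (block-offset s dp) h (toℕ l)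
      (+-cancelˡ-< 3 _ _ (subst (_< 3 + 2 * h) (trans (odd-index-block s dp l) (block-index-shape (toℕ s) (toℕ dp) (toℕ l))) lt)))
    x-before _ (inj₂ (inj₁ (p , u))) lt = unit-x h (unit-offset p) u
      (+-cancelˡ-< 3 _ _ (subst (_< 3 + 2 * h) (trans (odd-index-unit p u) (unit-index-shape S (toℕ p) (unit-index u))) lt))
    x-before sp≤ (inj₂ (inj₂ l)) lt = ⊥-elim (<-irrefl refl (≤-trans lt (≤-trans sp≤ after-units)))
      where
      after-units : corner-size + 4 * jx * unit-size ≤ toℕ (from odd-order (inj₂ (inj₂ l)))
      after-units = subst (corner-size + 4 * jx * unit-size ≤_) (trans (+-assoc corner-size _ (toℕ l)) (sym (odd-index-cornerY3 l))) (m≤m+n _ (toℕ l))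

    y-after : ∀ o → 3 + 2 * h ≤ toℕ (from odd-order o) → IsY (code o)
    y-after (inj₁ (inj₁ l)) le = proj₂ (level-split corner9 ≤-refl h l) (subst (3 + 2 * h ≤_) (odd-index-corner9 l) le)
    y-after (inj₁ (inj₂ (s , dp , l))) le = proj₂ (level-split block2×2 ≤-refl _ l) (≥-shift (block-offset s dp) h (toℕ l)
      (+-cancelˡ-≤ 3 _ _ (subst (3 + 2 * h ≤_) (trans (odd-index-block s dp l) (block-index-shape (toℕ s) (toℕ dp) (toℕ l))) le)))
    y-after (inj₂ (inj₁ (p , u))) le = unit-y h (unit-offset p) u
      (+-cancelˡ-≤ 3 _ _ (subst (3 + 2 * h ≤_) (trans (odd-index-unit p u) (unit-index-shape S (toℕ p) (unit-index u))) le))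
    y-after (inj₂ (inj₂ l)) _ = proj₂ (Template.code-split cornerY3 0F l) z≤n

  wide-odd-design : ∀ h rp → (3 + 2 * h) + rp ≡ 4 * x * y → 3 ≤ rp → Design (3 + 2 * h) rp
  wide-odd-design h rp sizes 3≤rp =
    ordered-design (3 + 2 * h) rp sizes odd-order odd-place (mk↔ₛ′ move move⁻ move-move⁻ move⁻-move) code
      move-step (x-before (corner-before rp sizes 3≤rp)) y-after
    where open WideOdd h

thin-even-size : ∀ jx → 4 * suc (2 * jx) * suc (2 * 0) ≡ 2 * suc (2 * jx) * 2
thin-even-size = solve-∀
thin-odd-size : ∀ jx → 4 * suc (2 * jx) * suc (2 * 0) ≡ 3 + (4 * jx * 2 + 1)
thin-odd-size = solve-∀

-- y = 1: every column is a single pair of cells, and the Y-step is the zero element.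
module ThinDesigns (jx : ℕ) where
  open Steps jx 0 public

  y₁-fixed : ∀ a c r → ⟦ a , c , r ⟧ ≡ ⟦ a , c , r ⟧ ⊹ step (inj₂ y₁)
  y₁-fixed a c r = ⟦⟧-step a c r 0 0 1 0 0 0 0 0 1
    (cong (_+ 2 * 0) (+-identityʳ a)) (cong (_+ 2 * x * 0) (+-identityʳ c)) (+-identityʳ (r + 1))

  pair-cells : Placement pair
  pair-cells = record { loc = loc ; shift = shift }
    where
      loc : Fin 2 → C
      loc l = ⟦ toℕ l , toℕ l , 0 ⟧
      shift : ∀ k l → loc (Template.move pair k l) ≡ loc l ⊹ step (Template.code pair k l)
      shift 0F 0F = y₁-fixed 0 0 0
      shift 0F 1F = y₁-fixed 1 1 0
      shift 1F 0F = x₁₁-move 0 0 0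
      shift 1F 1F = x₁₋₁-move 0 0

  thin-corner-cell : Fin 3 ⊎ Fin 1 → C
  thin-corner-cell z = ⟦ toℕ a , toℕ dp + toℕ a , 0 ⟧
    where
    dp = proj₁ (from thin-corner-layout z)
    a  = proj₂ (from thin-corner-layout z)

  cornerX3-cells : Placement cornerX3
  cornerX3-cells = record { loc = loc ; shift = shift }
    where
      loc : Fin 3 → C
      loc l = thin-corner-cell (inj₁ l)
      shift : ∀ k l → loc (Template.move cornerX3 k l) ≡ loc l ⊹ step (Template.code cornerX3 k l)
      shift 0F 0F = x₀₁-move 0
      shift 0F 1F = x₁₁-move 0 1 0
      shift 0F 2F = x₁₋₂-move 0

  fixedY-cells : Placement fixedY
  fixedY-cells = record { loc = λ l → thin-corner-cell (inj₂ l) ; shift = λ { 0F 0F → y₁-fixed 1 1 0 } }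

  column↔ : (Fin 2 × Fin 1) ↔ Fin 2
  column↔ = mk↔ₛ′ proj₁ (λ a → a , 0F) (λ _ → refl) (λ { (a , 0F) → refl ; (a , F.suc ()) })

  pair-cell : ∀ p l → to grid↔ (p , from column↔ l) ≡ ⟦ 0 , toℕ p , 0 ⟧ ⊹ Placement.loc pair-cells l
  pair-cell p l = ⟦⟧-+ 0 (toℕ p) 0 (toℕ l) (toℕ l) 0

  pair-step : ∀ k p l → to grid↔ (p , from column↔ (Template.move pair k l)) ≡ to grid↔ (p , from column↔ l) ⊹ step (Template.code pair k l)
  pair-step k p l = trans (pair-cell p (Template.move pair k l))
    (trans (Placement.shift-from pair-cells ⟦ 0 , toℕ p , 0 ⟧ k l) (cong (_⊹ step (Template.code pair k l)) (sym (pair-cell p l))))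

  thin-even-design : ∀ h rp → 2 * h + rp ≡ 4 * x * y → Design (2 * h) rp
  thin-even-design h rp sizes =
    ordered-design (2 * h) rp sizes order (grid↔ ↔-∘ ↔-sym (↔-id _ ×-↔ column↔)) move code
      (λ { (p , l) → pair-step (pair-level p) p l })
      (λ { (p , l) lt → proj₁ (level-split pair ≤-refl _ l) (<-shift (toℕ p) h (toℕ l) (subst (_< 2 * h) (index p l) lt)) })
      (λ { (p , l) le → proj₂ (level-split pair ≤-refl _ l) (≥-shift (toℕ p) h (toℕ l) (subst (2 * h ≤_) (index p l) le)) })
    where
    pair-level : Fin (2 * x) → Fin 2
    pair-level p = level 1 (h ∸ toℕ p)
    order : Fin (4 * x * y) ↔ (Fin (2 * x) × Fin 2)
    order = *↔× {2 * x} {2} ↔-∘ Fin-cast↔ (thin-even-size jx)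
    index : ∀ p l → toℕ (from order (p , l)) ≡ 2 * toℕ p + toℕ l
    index p l = trans (toℕ-Fin-cast↔⁻ (thin-even-size jx) _) (toℕ-combine p l)
    move : (Fin (2 * x) × Fin 2) ↔ (Fin (2 * x) × Fin 2)
    move = mk↔ₛ′ (λ { (p , l) → p , Template.move pair (pair-level p) l }) (λ { (p , l) → p , Template.move⁻ pair (pair-level p) l })
                 (λ { (p , l) → cong (p ,_) (Template.move-move⁻ pair _ l) }) (λ { (p , l) → cong (p ,_) (Template.move⁻-move pair _ l) })
    code : Fin (2 * x) × Fin 2 → Code
    code (p , l) = Template.code pair (pair-level p) l

  ThinOdd : Set
  ThinOdd = Fin 3 ⊎ ((Fin (4 * jx) × Fin 2) ⊎ Fin 1)

  thin-odd-place : ThinOdd ↔ C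
  thin-odd-place = grid↔ ↔-∘ ↔-sym (reorder ↔-∘ ((thin-corner-layout ⊎-↔ ↔-id _) ↔-∘ (×-distribʳ-⊎ _ _ _ _ ↔-∘ (columns↔ ×-↔ column↔))))
    where
    reorder : ∀ {A B C : Set} → ((A ⊎ B) ⊎ C) ↔ (A ⊎ (C ⊎ B))
    reorder = mk↔ₛ′ f g f∘g g∘f
      where
      f : _
      f (inj₁ (inj₁ a)) = inj₁ a
      f (inj₁ (inj₂ b)) = inj₂ (inj₂ b)
      f (inj₂ c)        = inj₂ (inj₁ c)
      g : _
      g (inj₁ a)        = inj₁ (inj₁ a)
      g (inj₂ (inj₂ b)) = inj₁ (inj₂ b)
      g (inj₂ (inj₁ c)) = inj₂ c
      f∘g : ∀ z → f (g z) ≡ z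
      f∘g (inj₁ a)        = refl
      f∘g (inj₂ (inj₂ b)) = refl
      f∘g (inj₂ (inj₁ c)) = refl
      g∘f : ∀ z → g (f z) ≡ z
      g∘f (inj₁ (inj₁ a)) = refl
      g∘f (inj₁ (inj₂ b)) = refl
      g∘f (inj₂ c)        = refl

  thin-odd-place-cornerX3 : ∀ l → to thin-odd-place (inj₁ l) ≡ Placement.loc cornerX3-cells l
  thin-odd-place-cornerX3 l = ⟦⟧-cong refl (cong (_+ _) (toℕ-columns↔⁻-first _)) refl

  thin-odd-place-fixedY : ∀ l → to thin-odd-place (inj₂ (inj₂ l)) ≡ Placement.loc fixedY-cells l
  thin-odd-place-fixedY l = ⟦⟧-cong refl (cong (_+ _) (toℕ-columns↔⁻-first _)) refl

  thin-odd-order : Fin (4 * x * y) ↔ ThinOdd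
  thin-odd-order = (↔-id _ ⊎-↔ ((*↔× {4 * jx} {2} ⊎-↔ ↔-id _) ↔-∘ +↔⊎ {4 * jx * 2} {1}))
                   ↔-∘ (+↔⊎ {3} {4 * jx * 2 + 1} ↔-∘ Fin-cast↔ (thin-odd-size jx))

  module ThinOdd (h : ℕ) where
    pair-level : Fin (4 * jx) → Fin 2
    pair-level p = level 1 (h ∸ toℕ p)

    move move⁻ : ThinOdd → ThinOdd
    move (inj₁ l)             = inj₁ (Template.move cornerX3 0F l)
    move (inj₂ (inj₁ (p , l))) = inj₂ (inj₁ (p , Template.move pair (pair-level p) l))
    move (inj₂ (inj₂ l))      = inj₂ (inj₂ (Template.move fixedY 0F l))
    move⁻ (inj₁ l)             = inj₁ (Template.move⁻ cornerX3 0F l)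
    move⁻ (inj₂ (inj₁ (p , l))) = inj₂ (inj₁ (p , Template.move⁻ pair (pair-level p) l))
    move⁻ (inj₂ (inj₂ l))      = inj₂ (inj₂ (Template.move⁻ fixedY 0F l))

    move-move⁻ : ∀ o → move (move⁻ o) ≡ o
    move-move⁻ (inj₁ l)             = cong inj₁ (Template.move-move⁻ cornerX3 0F l)
    move-move⁻ (inj₂ (inj₁ (p , l))) = cong (λ z → inj₂ (inj₁ (p , z))) (Template.move-move⁻ pair _ l)
    move-move⁻ (inj₂ (inj₂ l))      = cong (inj₂ ∘ inj₂) (Template.move-move⁻ fixedY 0F l)

    move⁻-move : ∀ o → move⁻ (move o) ≡ o
    move⁻-move (inj₁ l)             = cong inj₁ (Template.move⁻-move cornerX3 0F l)
    move⁻-move (inj₂ (inj₁ (p , l))) = cong (λ z → inj₂ (inj₁ (p , z))) (Template.move⁻-move pair _ l)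
    move⁻-move (inj₂ (inj₂ l))      = cong (inj₂ ∘ inj₂) (Template.move⁻-move fixedY 0F l)

    code : ThinOdd → Code
    code (inj₁ l)             = Template.code cornerX3 0F l
    code (inj₂ (inj₁ (p , l))) = Template.code pair (pair-level p) l
    code (inj₂ (inj₂ l))      = Template.code fixedY 0F l

    move-step : ∀ o → to thin-odd-place (move o) ≡ to thin-odd-place o ⊹ step (code o)
    move-step (inj₁ l) = trans (thin-odd-place-cornerX3 (Template.move cornerX3 0F l))
      (trans (Placement.shift cornerX3-cells 0F l) (cong (_⊹ step (code (inj₁ l))) (sym (thin-odd-place-cornerX3 l))))
    move-step (inj₂ (inj₁ (p , l))) = pair-step (pair-level p) (from columns↔ (inj₂ p)) l
    move-step (inj₂ (inj₂ l)) = trans (thin-odd-place-fixedY (Template.move fixedY 0F l))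
      (trans (Placement.shift fixedY-cells 0F l) (cong (_⊹ step (code (inj₂ (inj₂ l)))) (sym (thin-odd-place-fixedY l))))

    index-corner : ∀ l → toℕ (from thin-odd-order (inj₁ l)) ≡ toℕ l
    index-corner l = trans (toℕ-Fin-cast↔⁻ (thin-odd-size jx) _) (toℕ-↑ˡ l _)
    index-pair : ∀ p l → toℕ (from thin-odd-order (inj₂ (inj₁ (p , l)))) ≡ 3 + (2 * toℕ p + toℕ l)
    index-pair p l = trans (toℕ-Fin-cast↔⁻ (thin-odd-size jx) _) (trans (toℕ-↑ʳ 3 _) (cong (3 +_) (trans (toℕ-↑ˡ _ 1) (toℕ-combine p l))))
    index-fixed : ∀ l → toℕ (from thin-odd-order (inj₂ (inj₂ l))) ≡ 3 + (4 * jx * 2 + toℕ l)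
    index-fixed l = trans (toℕ-Fin-cast↔⁻ (thin-odd-size jx) _) (trans (toℕ-↑ʳ 3 _) (cong (3 +_) (toℕ-↑ʳ (4 * jx * 2) l)))

    pairs-before : ∀ rp → (3 + 2 * h) + rp ≡ 4 * x * y → 3 ≤ rp → 3 + 2 * h ≤ 3 + 4 * jx * 2
    pairs-before rp sizes 3≤rp = +-cancelʳ-≤ 1 (3 + 2 * h) _
      (subst (3 + 2 * h + 1 ≤_) (trans (trans sizes (thin-odd-size jx)) (sym (+-assoc 3 (4 * jx * 2) 1))) (+-monoʳ-≤ (3 + 2 * h) (≤-trans (s≤s z≤n) 3≤rp)))

    x-before : 3 + 2 * h ≤ 3 + 4 * jx * 2 → ∀ o → toℕ (from thin-odd-order o) < 3 + 2 * h → IsX (code o)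
    x-before _ (inj₁ l) _ = proj₁ (Template.code-split cornerX3 0F l) (toℕ<n l)
    x-before _ (inj₂ (inj₁ (p , l))) lt = proj₁ (level-split pair ≤-refl _ l)
      (<-shift (toℕ p) h (toℕ l) (+-cancelˡ-< 3 _ _ (subst (_< 3 + 2 * h) (index-pair p l) lt)))
    x-before sp≤ (inj₂ (inj₂ l)) lt = ⊥-elim (<-irrefl refl (≤-trans lt (≤-trans sp≤ after-pairs)))
      where
      after-pairs : 3 + 4 * jx * 2 ≤ toℕ (from thin-odd-order (inj₂ (inj₂ l)))
      after-pairs = subst (3 + 4 * jx * 2 ≤_) (trans (+-assoc 3 _ (toℕ l)) (sym (index-fixed l))) (m≤m+n _ (toℕ l))

    y-after : ∀ o → 3 + 2 * h ≤ toℕ (from thin-odd-order o) → IsY (code o)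
    y-after (inj₁ l) le = ⊥-elim (<-irrefl refl (≤-trans (subst (_< 3) (sym (index-corner l)) (toℕ<n l)) (≤-trans (m≤m+n 3 (2 * h)) le)))
    y-after (inj₂ (inj₁ (p , l))) le = proj₂ (level-split pair ≤-refl _ l)
      (≥-shift (toℕ p) h (toℕ l) (+-cancelˡ-≤ 3 _ _ (subst (3 + 2 * h ≤_) (index-pair p l) le)))
    y-after (inj₂ (inj₂ l)) _ = proj₂ (Template.code-split fixedY 0F l) z≤n

  thin-odd-design : ∀ h rp → (3 + 2 * h) + rp ≡ 4 * x * y → 3 ≤ rp → Design (3 + 2 * h) rp
  thin-odd-design h rp sizes 3≤rp =
    ordered-design (3 + 2 * h) rp sizes thin-odd-order thin-odd-place (mk↔ₛ′ move move⁻ move-move⁻ move⁻-move) code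
      move-step (x-before (pairs-before rp sizes 3≤rp)) y-after
    where open ThinOdd h

1+2[1+n]≡3+2*n : ∀ h → suc (2 * suc h) ≡ 3 + 2 * h
1+2[1+n]≡3+2*n = solve-∀
4xy≡2*2xy : ∀ a b → 4 * a * b ≡ 2 * (2 * a * b)
4xy≡2*2xy = solve-∀
2+2*n≡2*[1+n] : ∀ h → suc (suc (2 * h)) ≡ 2 * suc h
2+2*n≡2*[1+n] = solve-∀

parity : ∀ m → (Σ ℕ λ h → m ≡ 2 * h) ⊎ (Σ ℕ λ h → m ≡ suc (2 * h))
parity zero = inj₁ (0 , refl)
parity (suc m) with parity m
... | inj₁ (h , m≡2h)   = inj₂ (h , cong suc m≡2h)
... | inj₂ (h , m≡2h+1) = inj₁ (suc h , trans (cong suc m≡2h+1) (2+2*n≡2*[1+n] h))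

-- The complement of an odd sp ≠ v - 1 in an even v is odd and ≠ 1, hence ≥ 3.
odd-complement-≥3 : ∀ w h rp → (3 + 2 * h) + rp ≡ 2 * w → 3 + 2 * h ≢ 2 * w ∸ 1 → 3 ≤ rp
odd-complement-≥3 w h zero e _ = ⊥-elim (even≢odd w (suc h) (sym (trans (1+2[1+n]≡3+2*n h) (trans (sym (+-identityʳ _)) e))))
odd-complement-≥3 w h (suc zero) e ≢v-1 = ⊥-elim (≢v-1 (trans (sym (m+n∸n≡m (3 + 2 * h) 1)) (cong (_∸ 1) e)))
odd-complement-≥3 w h (suc (suc zero)) e _ = ⊥-elim (even≢odd w (suc (suc h)) (sym (trans (1+2[1+n]≡3+2*n (suc h)) (trans (shape h) e))))
  where
  shape : ∀ h → 3 + 2 * suc h ≡ 3 + 2 * h + 2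
  shape = solve-∀
odd-complement-≥3 w h (suc (suc (suc rp))) _ _ = s≤s (s≤s (s≤s z≤n))

Decomposes : (jx jy jn sp rp : ℕ) → Set
Decomposes jx jy jn sp rp =
  HasDecomposition (4 * suc (2 * jx) * suc (2 * jy)) n sp rp (2 * suc (2 * jx) * n) (suc (2 * jy) * n)
  where n = suc (2 * suc jn)

even-case : ∀ jx jy jn h rp → 2 * h + rp ≡ 4 * suc (2 * jx) * suc (2 * jy) → Decomposes jx jy jn (2 * h) rp
even-case jx zero    jn h rp sizes = Steps.FromDesign.decomposition-from-design jx 0 (ThinDesigns.thin-even-design jx h rp sizes) jn
even-case jx (suc S) jn h rp sizes = Steps.FromDesign.decomposition-from-design jx (suc S) (WideUnits.wide-even-design jx S h rp sizes) jn

odd-case : ∀ jx jy jn h rp → (3 + 2 * h) + rp ≡ 4 * suc (2 * jx) * suc (2 * jy) → 3 ≤ rp → Decomposes jx jy jn (3 + 2 * h) rp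
odd-case jx zero    jn h rp sizes 3≤rp = Steps.FromDesign.decomposition-from-design jx 0 (ThinDesigns.thin-odd-design jx h rp sizes 3≤rp) jn
odd-case jx (suc S) jn h rp sizes 3≤rp = Steps.FromDesign.decomposition-from-design jx (suc S) (WideUnits.wide-odd-design jx S h rp sizes 3≤rp) jn

decomposition-for : ∀ jx jy jn sp → let v = 4 * suc (2 * jx) * suc (2 * jy) in
  sp ≤ v → sp ≢ 1 → sp ≢ v ∸ 1 → Decomposes jx jy jn sp (v ∸ sp)
decomposition-for jx jy jn sp sp≤v sp≢1 sp≢v-1 with parity sp
... | inj₁ (h , refl)     = even-case jx jy jn h _ (m+[n∸m]≡n sp≤v)
... | inj₂ (zero , refl)  = ⊥-elim (sp≢1 refl)
... | inj₂ (suc h , refl) =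
  subst (λ s → Decomposes jx jy jn s (v ∸ s)) (sym (1+2[1+n]≡3+2*n h))
    (odd-case jx jy jn h (v ∸ (3 + 2 * h)) sizes (odd-complement-≥3 w h _ (trans sizes v≡2w) sp≢2w-1))
  where
  v w : ℕ
  v = 4 * suc (2 * jx) * suc (2 * jy)
  w = 2 * suc (2 * jx) * suc (2 * jy)
  v≡2w : v ≡ 2 * w
  v≡2w = 4xy≡2*2xy (suc (2 * jx)) (suc (2 * jy))
  sizes : (3 + 2 * h) + (v ∸ (3 + 2 * h)) ≡ v
  sizes = m+[n∸m]≡n (subst (_≤ v) (1+2[1+n]≡3+2*n h) sp≤v)
  sp≢2w-1 : 3 + 2 * h ≢ 2 * w ∸ 1
  sp≢2w-1 e = sp≢v-1 (trans (1+2[1+n]≡3+2*n h) (trans e (cong (_∸ 1) (sym v≡2w))))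

lemma7p17 : (x y n sp : ℕ) → IsOdd x → IsOdd y → IsOdd n → 3 ≤ n →
    sp ≤ 4 * x * y → sp ≢ 1 → sp ≢ 4 * x * y ∸ 1 →
    HasDecomposition (4 * x * y) n sp (4 * x * y ∸ sp) (2 * x * n) (y * n)
lemma7p17 _ _ _ sp (jx , refl) (jy , refl) (zero , refl) (s≤s ())
lemma7p17 _ _ _ sp (jx , refl) (jy , refl) (suc jn , refl) _ = decomposition-for jx jy jn sp
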